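{- Let $p>3$ be a prime. Then $$\sum_{k=0}^{p-1} kH_k^{(2)}\equiv -\frac{p^2}{2}B_{p-3}-\frac{p}{2}+\frac12 \pmod{p^3},\qquad \sum_{k=0}^{p-1}kH_k^{(3)}\equiv \frac13 pB_{p-3}\pmod{p^2},\qquad \sum_{k=0}^{p-1}kH_k^{(4)}\equiv 0\pmod p.$$
   Context: $H_k^{(m)}=\sum_{i=1}^k 1/i^m$ denotes the $k$-th harmonic number of order $m$ (with $H_0^{(m)}=0$), and $B_n$ denotes the $n$-th Bernoulli number. Congruences between rational numbers are understood in the ring of rationals whose denominators are prime to $p$. -}

module Defs where

open import Data.Nat as ℕ using (ℕ; zero; suc; _^_)
open import Data.Nat.Divisibility using (_∣_)
open import Data.Nat.Combinatorics using (_C_)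
open import Data.Integer as ℤ using (ℤ; +_)
open import Data.Rational as ℚ using (ℚ; _+_; _*_; _-_; -_; ↥_; ↧ₙ_; 0ℚ; 1ℚ)
open import Data.List using (List; []; _∷_; length; reverse)
open import Relation.Nullary using (¬_)
open import Data.Product using (_×_)

sumℚ : ℕ → (ℕ → ℚ) → ℚ
sumℚ zero    f = 0ℚ
sumℚ (suc n) f = sumℚ n f + f n

ℕ→ℚ : ℕ → ℚ
ℕ→ℚ n = (+ n) ℚ./ 1

inv-pow : ℕ → ℕ → ℚ
inv-pow i zero    = 1ℚ                                  -- = 1 / (i+1)^m
inv-pow i (suc m) = ((+ 1) ℚ./ suc i) * inv-pow i m

-- generalized harmonic number H_k^{(m)} = Σ_{i=1}^k 1/i^m, H_0^{(m)} = 0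
H : ℕ → ℕ → ℚ
H m k = sumℚ k (λ i → inv-pow i m)

-- Bernoulli numbers via B_0 = 1 and  Σ_{j=0}^{n} C(n+1,j) B_j = 0  (n ≥ 1),
-- i.e. B_n = -(1/(n+1)) Σ_{j<n} C(n+1,j) B_j   (convention B_1 = -1/2).
-- bernList n = [B_{n-1}, ..., B_1, B_0] (most recent first)
private
  nthRev : List ℚ → ℕ → ℚ
  nthRev l j = go (reverse l) j
    where
    go : List ℚ → ℕ → ℚ
    go []       _       = 0ℚ
    go (x ∷ _)  zero    = x
    go (_ ∷ xs) (suc j) = go xs j

bernList : ℕ → List ℚ
bernList zero    = []
bernList (suc n) =
  let prev = bernList n
      Bn : ℚ
      Bn = bernStep n prev
  in Bn ∷ prev
  where
  bernStep : ℕ → List ℚ → ℚ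
  bernStep zero    _    = 1ℚ
  bernStep (suc k) prev =
    - (((+ 1) ℚ./ (suc (suc k))) *
        sumℚ (suc k) (λ j → ℕ→ℚ (suc (suc k) C j) * nthRev prev j))

bernoulli : ℕ → ℚ
bernoulli n with bernList (suc n)
... | []    = 0ℚ
... | b ∷ _ = b

-- congruence in Z_(p): x ≡ y (mod p^e) iff x - y = a/b (lowest terms)
-- with p ∤ b and p^e ∣ a
_≡_[modℚ_^_] : ℚ → ℚ → ℕ → ℕ → Set
x ≡ y [modℚ p ^ e ] = (¬ (p ∣ ↧ₙ (x - y))) × ((p ^ e) ∣ ℤ.∣ ↥ (x - y) ∣)

-- Summation by parts reduces each sum to the harmonic numbers H^(m) := H_{p-1}^(m):
-- 2 Σ_{k<p} k H_k^(m+2) = p (p - 1) H^(m+2) - H^(m) + H^(m+1).  Pairing i with p - i gives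
-- 2 H^(1) = - p H^(2) - p² H^(3) + p³ R₁ and 2 H^(3) = p R₃ with p-integral R₁, R₃.  The remaining
-- input, 3 H^(2) ≡ 2 p B_{p-3} (mod p²), comes from the elementary symmetric functions σ_k of
-- 1, …, p - 1: the Bernoulli recurrence gives Σ_{i<p} i^k ≡ p B_k (mod p²) for k ≤ p - 2, so Newton's
-- identities yield σ_k ≡ 0 (mod p) for 0 < k < p - 1, Wilson's theorem, and in degree p - 3, where
-- σ_{p-3} = (p - 1)! H^(1,1), the congruence 3 H^(1,1) ≡ - p B_{p-3} (mod p²).  Finally
-- (H^(1))² = H^(2) + 2 H^(1,1) and p ∣ H^(1).

module Submission where

open import Defs
open import Data.Nat as ℕ using (ℕ; zero; suc; _∸_; _^_; _!; s≤s; z≤n; _<_)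
import Data.Nat.Properties as ℕP
open import Data.Nat.Induction using (<-rec)
open import Data.Nat.Divisibility as ℕ∣ using (_∣_; divides)
open import Data.Nat.Primality using (Prime; euclidsLemma; prime⇒nonTrivial; prime⇒nonZero; prime⇒irreducible)
open import Data.Nat.Coprimality using (Coprime; coprime?)
open import Data.Nat.Combinatorics using (_C_; nCn≡1; nC1≡n; nCk≡nC[n∸k]; k>n⇒nCk≡0; nCk+nC[k+1]≡[n+1]C[k+1])
import Data.Nat.Solver as ℕSolver
open import Data.Integer as ℤ using (ℤ; +_)
import Data.Integer.Properties as ℤP
open import Data.Rational as ℚ using (ℚ; mkℚ; 0ℚ; 1ℚ; _+_; _*_; _-_; -_; _/_)
import Data.Rational.Properties as ℚP
import Data.Rational.Unnormalised as U
import Data.Rational.Unnormalised.Properties as UP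
open import Data.Rational.Solver using (module +-*-Solver)
open import Data.List using (List; []; _∷_; reverse; _++_; length; [_])
import Data.List.Properties as LP
open import Data.Product using (Σ; _×_; _,_; proj₁; proj₂; ∃-syntax)
open import Data.Sum using (_⊎_; inj₁; inj₂; [_,_]′)
open import Relation.Nullary using (¬_; contradiction)
open import Relation.Nullary.Decidable using (recompute)
open import Relation.Binary.PropositionalEquality hiding ([_])

open +-*-Solver using (solve; _:=_; _:+_; _:*_; :-_; _:-_; con)
open ℕSolver.+-*-Solver using () renaming (solve to solveℕ; _:=_ to _:=ℕ_; _:*_ to _:*ℕ_)

ℤ→ℚ : ℤ → ℚ
ℤ→ℚ a = a / 1

toℚᵘ-ℤ→ℚ : ∀ a → ℚ.toℚᵘ (ℤ→ℚ a) U.≃ U.mkℚᵘ a 0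
toℚᵘ-ℤ→ℚ a = ℚP.toℚᵘ-fromℚᵘ (U.mkℚᵘ a 0)

ℤ→ℚ-+ : ∀ a b → ℤ→ℚ (a ℤ.+ b) ≡ ℤ→ℚ a + ℤ→ℚ b
ℤ→ℚ-+ a b = ℚP.toℚᵘ-injective (UP.≃-trans (toℚᵘ-ℤ→ℚ (a ℤ.+ b)) (UP.≃-sym (UP.≃-trans
  (ℚP.toℚᵘ-homo-+ (ℤ→ℚ a) (ℤ→ℚ b))
  (UP.≃-trans (UP.+-cong (toℚᵘ-ℤ→ℚ a) (toℚᵘ-ℤ→ℚ b))
    (U.*≡* (cong (ℤ._* + 1) (cong₂ ℤ._+_ (ℤP.*-identityʳ a) (ℤP.*-identityʳ b))))))))

ℤ→ℚ-* : ∀ a b → ℤ→ℚ (a ℤ.* b) ≡ ℤ→ℚ a * ℤ→ℚ b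
ℤ→ℚ-* a b = ℚP.toℚᵘ-injective (UP.≃-trans (toℚᵘ-ℤ→ℚ (a ℤ.* b)) (UP.≃-sym (UP.≃-trans
  (ℚP.toℚᵘ-homo-* (ℤ→ℚ a) (ℤ→ℚ b))
  (UP.≃-trans (UP.*-cong (toℚᵘ-ℤ→ℚ a) (toℚᵘ-ℤ→ℚ b)) (U.*≡* refl)))))

ℤ→ℚ-neg : ∀ a → ℤ→ℚ (ℤ.- a) ≡ - ℤ→ℚ a
ℤ→ℚ-neg a = ℚP.toℚᵘ-injective (UP.≃-trans (toℚᵘ-ℤ→ℚ (ℤ.- a)) (UP.≃-sym (UP.≃-trans
  (ℚP.toℚᵘ-homo‿- (ℤ→ℚ a)) (UP.-‿cong (toℚᵘ-ℤ→ℚ a)))))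

ℕ→ℚ-+ : ∀ m n → ℕ→ℚ (m ℕ.+ n) ≡ ℕ→ℚ m + ℕ→ℚ n
ℕ→ℚ-+ m n = ℤ→ℚ-+ (+ m) (+ n)

ℕ→ℚ-* : ∀ m n → ℕ→ℚ (m ℕ.* n) ≡ ℕ→ℚ m * ℕ→ℚ n
ℕ→ℚ-* m n = trans (cong ℤ→ℚ (ℤP.pos-* m n)) (ℤ→ℚ-* (+ m) (+ n))

ℕ→ℚ-suc : ∀ n → ℕ→ℚ (suc n) ≡ ℕ→ℚ n + 1ℚ
ℕ→ℚ-suc n = trans (ℕ→ℚ-+ 1 n) (ℚP.+-comm 1ℚ (ℕ→ℚ n))

1/suc : ℕ → ℚ
1/suc n = + 1 / suc n

1/suc-inverse : ∀ n → 1/suc n * ℕ→ℚ (suc n) ≡ 1ℚ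
1/suc-inverse n = ℚP.toℚᵘ-injective (UP.≃-trans (ℚP.toℚᵘ-homo-* (1/suc n) (ℕ→ℚ (suc n)))
  (UP.≃-trans (UP.*-cong (ℚP.toℚᵘ-fromℚᵘ (U.mkℚᵘ (+ 1) n)) (toℚᵘ-ℤ→ℚ (+ suc n)))
    (U.*≡* (trans (ℤP.*-identityʳ _) (cong (λ m → + 1 ℤ.* + m) (sym (ℕP.*-identityʳ (suc n))))))))

*-inverse-cancelˡ : ∀ u y x → u * y ≡ 1ℚ → u * (y * x) ≡ x
*-inverse-cancelˡ u y x uy≡1 = trans (sym (ℚP.*-assoc u y x)) (trans (cong (_* x) uy≡1) (ℚP.*-identityˡ x))

1/suc-solve : ∀ n {x y} → ℕ→ℚ (suc n) * x ≡ y → x ≡ 1/suc n * y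
1/suc-solve n {x} nx≡y =
  trans (sym (*-inverse-cancelˡ (1/suc n) (ℕ→ℚ (suc n)) x (1/suc-inverse n))) (cong (1/suc n *_) nx≡y)

[1+n]C[n]≡1+n : ∀ n → suc n C n ≡ suc n
[1+n]C[n]≡1+n n = trans (nCk≡nC[n∸k] (ℕP.n≤1+n n)) (trans (cong (suc n C_) (ℕP.m+n∸n≡m 1 n)) (nC1≡n (suc n)))

[1+k]*[1+n]C[1+k]≡[1+n]*nCk : ∀ n k → suc k ℕ.* (suc n C suc k) ≡ suc n ℕ.* (n C k)
[1+k]*[1+n]C[1+k]≡[1+n]*nCk zero    zero    = refl
[1+k]*[1+n]C[1+k]≡[1+n]*nCk zero    (suc k) = begin
  suc (suc k) ℕ.* (1 C suc (suc k))  ≡⟨ cong (suc (suc k) ℕ.*_) (k>n⇒nCk≡0 {1} {suc (suc k)} (s≤s (s≤s z≤n))) ⟩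
  suc (suc k) ℕ.* 0                  ≡⟨ ℕP.*-zeroʳ (suc (suc k)) ⟩
  0                                  ≡⟨ k>n⇒nCk≡0 {0} {suc k} (s≤s z≤n) ⟨
  0 C suc k                          ≡⟨ ℕP.*-identityˡ (0 C suc k) ⟨
  1 ℕ.* (0 C suc k)                  ∎
  where open ≡-Reasoning
[1+k]*[1+n]C[1+k]≡[1+n]*nCk (suc n) zero    = trans (ℕP.*-identityˡ _) (trans (nC1≡n (suc (suc n))) (sym (ℕP.*-identityʳ (suc (suc n)))))
[1+k]*[1+n]C[1+k]≡[1+n]*nCk (suc n) (suc k) = begin
  suc (suc k) ℕ.* (suc (suc n) C suc (suc k))
    ≡⟨ cong (suc (suc k) ℕ.*_) (nCk+nC[k+1]≡[n+1]C[k+1] (suc n) (suc k)) ⟨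
  suc (suc k) ℕ.* (a ℕ.+ b)
    ≡⟨ ℕP.*-distribˡ-+ (suc (suc k)) a b ⟩
  (a ℕ.+ suc k ℕ.* a) ℕ.+ suc (suc k) ℕ.* b
    ≡⟨ cong₂ (λ x y → (a ℕ.+ x) ℕ.+ y) ([1+k]*[1+n]C[1+k]≡[1+n]*nCk n k) ([1+k]*[1+n]C[1+k]≡[1+n]*nCk n (suc k)) ⟩
  (a ℕ.+ suc n ℕ.* (n C k)) ℕ.+ suc n ℕ.* (n C suc k)
    ≡⟨ ℕP.+-assoc a _ _ ⟩
  a ℕ.+ (suc n ℕ.* (n C k) ℕ.+ suc n ℕ.* (n C suc k))
    ≡⟨ cong (a ℕ.+_) (trans (sym (ℕP.*-distribˡ-+ (suc n) (n C k) (n C suc k))) (cong (suc n ℕ.*_) (nCk+nC[k+1]≡[n+1]C[k+1] n k))) ⟩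
  a ℕ.+ suc n ℕ.* a
    ≡⟨⟩
  suc (suc n) ℕ.* a  ∎
  where
  open ≡-Reasoning
  a b : ℕ
  a = suc n C suc k
  b = suc n C suc (suc k)

sumℚ-cong : ∀ n {f g : ℕ → ℚ} → (∀ i → i ℕ.< n → f i ≡ g i) → sumℚ n f ≡ sumℚ n g
sumℚ-cong zero    f≡g = refl
sumℚ-cong (suc n) f≡g = cong₂ _+_ (sumℚ-cong n (λ i i<n → f≡g i (ℕP.m<n⇒m<1+n i<n))) (f≡g n ℕP.≤-refl)

sumℚ-+ : ∀ n (f g : ℕ → ℚ) → sumℚ n (λ i → f i + g i) ≡ sumℚ n f + sumℚ n g
sumℚ-+ zero    f g = refl
sumℚ-+ (suc n) f g = trans (cong (_+ (f n + g n)) (sumℚ-+ n f g))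
  (solve 4 (λ a b c d → (a :+ b) :+ (c :+ d) := (a :+ c) :+ (b :+ d)) refl (sumℚ n f) (sumℚ n g) (f n) (g n))

sumℚ-*ˡ : ∀ n c (f : ℕ → ℚ) → sumℚ n (λ i → c * f i) ≡ c * sumℚ n f
sumℚ-*ˡ zero    c f = sym (ℚP.*-zeroʳ c)
sumℚ-*ˡ (suc n) c f = trans (cong (_+ (c * f n)) (sumℚ-*ˡ n c f)) (sym (ℚP.*-distribˡ-+ c (sumℚ n f) (f n)))

sumℚ-neg : ∀ n (f : ℕ → ℚ) → sumℚ n (λ i → - f i) ≡ - sumℚ n f
sumℚ-neg zero    f = refl
sumℚ-neg (suc n) f = trans (cong (_+ (- f n)) (sumℚ-neg n f)) (sym (ℚP.neg-distrib-+ (sumℚ n f) (f n)))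

sumℚ-- : ∀ n (f g : ℕ → ℚ) → sumℚ n (λ i → f i - g i) ≡ sumℚ n f - sumℚ n g
sumℚ-- n f g = trans (sumℚ-+ n f (λ i → - g i)) (cong (λ s → sumℚ n f + s) (sumℚ-neg n g))

sumℚ-0 : ∀ n → sumℚ n (λ _ → 0ℚ) ≡ 0ℚ
sumℚ-0 zero    = refl
sumℚ-0 (suc n) = cong (_+ 0ℚ) (sumℚ-0 n)

sumℚ-const : ∀ n c → sumℚ n (λ _ → c) ≡ ℕ→ℚ n * c
sumℚ-const zero    c = sym (ℚP.*-zeroˡ c)
sumℚ-const (suc n) c = begin
  sumℚ n (λ _ → c) + c   ≡⟨ cong (_+ c) (sumℚ-const n c) ⟩
  ℕ→ℚ n * c + c          ≡⟨ solve 2 (λ m c → m :* c :+ c := (m :+ con 1ℚ) :* c) refl (ℕ→ℚ n) c ⟩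
  (ℕ→ℚ n + 1ℚ) * c       ≡⟨ cong (_* c) (ℕ→ℚ-suc n) ⟨
  ℕ→ℚ (suc n) * c        ∎
  where open ≡-Reasoning

sumℚ-unshift : ∀ n (f : ℕ → ℚ) → sumℚ (suc n) f ≡ f 0 + sumℚ n (λ i → f (suc i))
sumℚ-unshift zero    f = trans (ℚP.+-identityˡ (f 0)) (sym (ℚP.+-identityʳ (f 0)))
sumℚ-unshift (suc n) f = trans (cong (_+ f (suc n)) (sumℚ-unshift n f)) (ℚP.+-assoc (f 0) _ _)

sumℚ-comm : ∀ a b (f : ℕ → ℕ → ℚ) → sumℚ a (λ i → sumℚ b (f i)) ≡ sumℚ b (λ k → sumℚ a (λ i → f i k))
sumℚ-comm zero    b f = sym (sumℚ-0 b)
sumℚ-comm (suc a) b f = trans (cong (_+ sumℚ b (f a)) (sumℚ-comm a b f))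
  (sym (sumℚ-+ b (λ k → sumℚ a (λ i → f i k)) (f a)))

sumℚ-reverse : ∀ n (f : ℕ → ℚ) → sumℚ n f ≡ sumℚ n (λ i → f (n ∸ suc i))
sumℚ-reverse zero    f = refl
sumℚ-reverse (suc n) f = trans (cong (_+ f n) (sumℚ-reverse n f))
  (trans (ℚP.+-comm _ (f n)) (sym (sumℚ-unshift n (λ i → f (n ∸ i)))))

sumℚ-telescope : ∀ n (g : ℕ → ℚ) → sumℚ n (λ i → g (suc i) - g i) ≡ g n - g 0
sumℚ-telescope zero    g = sym (ℚP.+-inverseʳ (g 0))
sumℚ-telescope (suc n) g = trans (cong (_+ (g (suc n) - g n)) (sumℚ-telescope n g))
  (solve 3 (λ a b c → (b :- a) :+ (c :- b) := c :- a) refl (g 0) (g n) (g (suc n)))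

sumℚ-last : ∀ n (f : ℕ → ℚ) {c} → sumℚ (suc n) f ≡ c → f n ≡ c - sumℚ n f
sumℚ-last n f {c} sum≡c = trans (solve 2 (λ s y → y := (s :+ y) :- s) refl (sumℚ n f) (f n)) (cong (_- sumℚ n f) sum≡c)

sumℚ-reflect-pairs : ∀ n (f : ℕ → ℚ) → ℕ→ℚ 2 * sumℚ n f ≡ sumℚ n (λ i → f i + f (n ∸ suc i))
sumℚ-reflect-pairs n f = begin
  ℕ→ℚ 2 * sumℚ n f                           ≡⟨ solve 1 (λ s → con (ℕ→ℚ 2) :* s := s :+ s) refl (sumℚ n f) ⟩
  sumℚ n f + sumℚ n f                        ≡⟨ cong (λ s → sumℚ n f + s) (sumℚ-reverse n f) ⟩
  sumℚ n f + sumℚ n (λ i → f (n ∸ suc i))    ≡⟨ sumℚ-+ n _ _ ⟨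
  sumℚ n (λ i → f i + f (n ∸ suc i))         ∎
  where open ≡-Reasoning

drop-vanishing-multiple : ∀ {r} c x y → r ≡ 0ℚ → x ≡ y + r * c → x ≡ y
drop-vanishing-multiple {r} c x y r≡0 x≡y+rc = begin
  x          ≡⟨ x≡y+rc ⟩
  y + r * c  ≡⟨ cong (λ z → y + z * c) r≡0 ⟩
  y + 0ℚ * c ≡⟨ solve 2 (λ y c → y :+ con 0ℚ :* c := y) refl y c ⟩
  y          ∎
  where open ≡-Reasoning

pascal-term : ∀ m x k →
  ℕ→ℚ (suc m C suc k) * ℕ→ℚ (x ^ suc k)
    ≡ ℕ→ℚ x * (ℕ→ℚ (m C k) * ℕ→ℚ (x ^ k)) + ℕ→ℚ (m C suc k) * ℕ→ℚ (x ^ suc k)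
pascal-term m x k = begin
  ℕ→ℚ (suc m C suc k) * ℕ→ℚ (x ^ suc k)
    ≡⟨ cong (λ c → ℕ→ℚ c * ℕ→ℚ (x ^ suc k)) (nCk+nC[k+1]≡[n+1]C[k+1] m k) ⟨
  ℕ→ℚ (m C k ℕ.+ m C suc k) * ℕ→ℚ (x ^ suc k)
    ≡⟨ cong₂ _*_ (ℕ→ℚ-+ (m C k) (m C suc k)) (ℕ→ℚ-* x (x ^ k)) ⟩
  (a + b) * (ℕ→ℚ x * y)
    ≡⟨ solve 4 (λ a b x y → (a :+ b) :* (x :* y) := x :* (a :* y) :+ b :* (x :* y)) refl a b (ℕ→ℚ x) y ⟩
  ℕ→ℚ x * (a * y) + b * (ℕ→ℚ x * y)
    ≡⟨ cong (λ z → ℕ→ℚ x * (a * y) + b * z) (ℕ→ℚ-* x (x ^ k)) ⟨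
  ℕ→ℚ x * (a * y) + b * ℕ→ℚ (x ^ suc k)  ∎
  where
  open ≡-Reasoning
  a b y : ℚ
  a = ℕ→ℚ (m C k)
  b = ℕ→ℚ (m C suc k)
  y = ℕ→ℚ (x ^ k)

binomial-1+x : ∀ m x → sumℚ (suc m) (λ k → ℕ→ℚ (m C k) * ℕ→ℚ (x ^ k)) ≡ ℕ→ℚ (suc x ^ m)
binomial-1+x zero    x = refl
binomial-1+x (suc m) x = begin
  sumℚ (suc (suc m)) (λ k → ℕ→ℚ (suc m C k) * ℕ→ℚ (x ^ k))
    ≡⟨ sumℚ-unshift (suc m) _ ⟩
  1ℚ * 1ℚ + sumℚ (suc m) (λ k → ℕ→ℚ (suc m C suc k) * ℕ→ℚ (x ^ suc k))
    ≡⟨ cong (λ s → 1ℚ * 1ℚ + s) (trans (sumℚ-cong (suc m) (λ k _ → pascal-term m x k)) (sumℚ-+ (suc m) _ _)) ⟩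
  1ℚ * 1ℚ + (sumℚ (suc m) (λ k → ℕ→ℚ x * f k) + sumℚ (suc m) (λ k → f (suc k)))
    ≡⟨ cong₂ (λ u v → 1ℚ * 1ℚ + (u + v)) (trans (sumℚ-*ˡ (suc m) (ℕ→ℚ x) f) (cong (ℕ→ℚ x *_) (binomial-1+x m x))) shifted ⟩
  1ℚ * 1ℚ + (ℕ→ℚ x * Y + (Y - 1ℚ * 1ℚ))
    ≡⟨ solve 2 (λ x Y → con 1ℚ :* con 1ℚ :+ (x :* Y :+ (Y :- con 1ℚ :* con 1ℚ)) := (x :+ con 1ℚ) :* Y) refl (ℕ→ℚ x) Y ⟩
  (ℕ→ℚ x + 1ℚ) * Y
    ≡⟨ trans (ℕ→ℚ-* (suc x) (suc x ^ m)) (cong (_* Y) (ℕ→ℚ-suc x)) ⟨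
  ℕ→ℚ (suc x ^ suc m)  ∎
  where
  open ≡-Reasoning
  f : ℕ → ℚ
  f k = ℕ→ℚ (m C k) * ℕ→ℚ (x ^ k)
  Y : ℚ
  Y = ℕ→ℚ (suc x ^ m)
  top-vanishes : f (suc m) ≡ 0ℚ
  top-vanishes = trans (cong (λ c → ℕ→ℚ c * ℕ→ℚ (x ^ suc m)) (k>n⇒nCk≡0 (ℕP.n<1+n m))) (ℚP.*-zeroˡ (ℕ→ℚ (x ^ suc m)))
  shifted : sumℚ (suc m) (λ k → f (suc k)) ≡ Y - 1ℚ * 1ℚ
  shifted = begin
    sumℚ (suc m) (λ k → f (suc k))             ≡⟨ solve 2 (λ a s → s := (a :+ s) :- a) refl (f 0) _ ⟩
    (f 0 + sumℚ (suc m) (λ k → f (suc k))) - f 0 ≡⟨ cong (_- f 0) (sumℚ-unshift (suc m) f) ⟨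
    sumℚ (suc (suc m)) f - 1ℚ * 1ℚ             ≡⟨ cong (λ s → s - 1ℚ * 1ℚ) (cong (λ y → sumℚ (suc m) f + y) top-vanishes) ⟩
    (sumℚ (suc m) f + 0ℚ) - 1ℚ * 1ℚ            ≡⟨ cong (λ s → s - 1ℚ * 1ℚ) (trans (ℚP.+-identityʳ _) (binomial-1+x m x)) ⟩
    Y - 1ℚ * 1ℚ                                ∎

powerSum : ℕ → ℕ → ℚ
powerSum N k = sumℚ N (λ i → ℕ→ℚ (i ^ k))

powerSum-binomial : ∀ N n → sumℚ (suc n) (λ k → ℕ→ℚ (suc n C k) * powerSum N k) ≡ ℕ→ℚ (N ^ suc n)
powerSum-binomial N n = begin
  sumℚ (suc n) (λ k → ℕ→ℚ (suc n C k) * powerSum N k)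
    ≡⟨ sumℚ-cong (suc n) (λ k _ → sym (sumℚ-*ˡ N (ℕ→ℚ (suc n C k)) (λ i → ℕ→ℚ (i ^ k)))) ⟩
  sumℚ (suc n) (λ k → sumℚ N (λ i → ℕ→ℚ (suc n C k) * ℕ→ℚ (i ^ k)))
    ≡⟨ sumℚ-comm (suc n) N _ ⟩
  sumℚ N (λ i → sumℚ (suc n) (λ k → ℕ→ℚ (suc n C k) * ℕ→ℚ (i ^ k)))
    ≡⟨ sumℚ-cong N (λ i _ → difference i) ⟩
  sumℚ N (λ i → ℕ→ℚ (suc i ^ suc n) - ℕ→ℚ (i ^ suc n))
    ≡⟨ sumℚ-telescope N (λ i → ℕ→ℚ (i ^ suc n)) ⟩
  ℕ→ℚ (N ^ suc n) - 0ℚ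
    ≡⟨ ℚP.+-identityʳ _ ⟩
  ℕ→ℚ (N ^ suc n)  ∎
  where
  open ≡-Reasoning
  difference : ∀ i → sumℚ (suc n) (λ k → ℕ→ℚ (suc n C k) * ℕ→ℚ (i ^ k)) ≡ ℕ→ℚ (suc i ^ suc n) - ℕ→ℚ (i ^ suc n)
  difference i = begin
    s                                             ≡⟨ solve 2 (λ s c → s := (s :+ c) :- c) refl s c ⟩
    (s + c) - c                                   ≡⟨ cong (λ t → (s + t) - c) (sym (trans (cong (λ t → ℕ→ℚ t * c) (nCn≡1 (suc n))) (ℚP.*-identityˡ c))) ⟩
    (s + ℕ→ℚ (suc n C suc n) * c) - c             ≡⟨ cong (_- c) (binomial-1+x (suc n) i) ⟩
    ℕ→ℚ (suc i ^ suc n) - c                       ∎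
    where
    s c : ℚ
    s = sumℚ (suc n) (λ k → ℕ→ℚ (suc n C k) * ℕ→ℚ (i ^ k))
    c = ℕ→ℚ (i ^ suc n)

lookup₀ : List ℚ → ℕ → ℚ
lookup₀ []       _       = 0ℚ
lookup₀ (x ∷ _)  zero    = x
lookup₀ (_ ∷ xs) (suc k) = lookup₀ xs k

lookup₀-unique : {A : Set} (g : A → List ℚ → ℕ → ℚ) → (∀ a k → g a [] k ≡ 0ℚ) → (∀ a x xs → g a (x ∷ xs) 0 ≡ x) →
  (∀ a x xs k → g a (x ∷ xs) (suc k) ≡ g a xs k) → ∀ a xs k → g a xs k ≡ lookup₀ xs k
lookup₀-unique g g[] g-head g-tail a []       k       = g[] a k
lookup₀-unique g g[] g-head g-tail a (x ∷ xs) zero    = g-head a x xs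
lookup₀-unique g g[] g-head g-tail a (x ∷ xs) (suc k) = trans (g-tail a x xs k) (lookup₀-unique g g[] g-head g-tail a xs k)

-- Defs reads the earlier Bernoulli numbers through a private indexing function; the Σ lets
-- unification name it.
bernoulli-defining : Σ (ℕ → ℕ → ℚ) λ earlier → ∀ m →
  bernoulli (suc m) ≡ - (1/suc (suc m) * sumℚ (suc m) (λ j → ℕ→ℚ (suc (suc m) C j) * earlier m j))
bernoulli-defining = _ , λ m → refl

earlier : ℕ → ℕ → ℚ
earlier = proj₁ bernoulli-defining

earlier≡lookup₀ : ∀ m j → earlier m j ≡ lookup₀ (reverse (bernList (suc m))) j
earlier≡lookup₀ m j with reverse (bernList (suc m))
earlier≡lookup₀ m j       | []     = refl
earlier≡lookup₀ m zero    | x ∷ xs = refl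
earlier≡lookup₀ m (suc j) | x ∷ xs
  -- The private indexer also receives the index as a parameter; abstracting its occurrences
  -- separately turns its identification into a pattern unification problem.
  with lookup₀-unique (λ J ys k → _) (λ _ _ → refl) (λ _ _ _ → refl) (λ _ _ _ _ → refl) | suc j | xs | j
... | unique | J | ys | k = unique J ys k

lookup₀-++ˡ : ∀ l r k → k ℕ.< length l → lookup₀ (l ++ r) k ≡ lookup₀ l k
lookup₀-++ˡ (y ∷ l) r zero    _         = refl
lookup₀-++ˡ (y ∷ l) r (suc k) (s≤s k<l) = lookup₀-++ˡ l r k k<l

lookup₀-++-length : ∀ l x r → lookup₀ (l ++ x ∷ r) (length l) ≡ x
lookup₀-++-length []      x r = refl
lookup₀-++-length (y ∷ l) x r = lookup₀-++-length l x r

length-reverse-bernList : ∀ m → length (reverse (bernList m)) ≡ m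
length-reverse-bernList m = trans (LP.length-reverse (bernList m)) (length-bernList m)
  where
  length-bernList : ∀ m → length (bernList m) ≡ m
  length-bernList zero    = refl
  length-bernList (suc m) = cong suc (length-bernList m)

lookup₀-reverse-bernList : ∀ m j → j ℕ.≤ m → lookup₀ (reverse (bernList (suc m))) j ≡ bernoulli j
lookup₀-reverse-bernList m j j≤m
  rewrite LP.unfold-reverse (bernoulli m) (bernList m) with ℕP.m≤n⇒m<n∨m≡n j≤m
... | inj₁ j<m@(s≤s j≤m-1) =
  trans (lookup₀-++ˡ (reverse (bernList m)) [ bernoulli m ] j (subst (j ℕ.<_) (sym (length-reverse-bernList m)) j<m))
        (lookup₀-reverse-bernList _ j j≤m-1)
... | inj₂ refl = subst (λ k → lookup₀ (reverse (bernList j) ++ [ bernoulli j ]) k ≡ bernoulli j)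
  (length-reverse-bernList j) (lookup₀-++-length (reverse (bernList j)) (bernoulli j) [])

bernoulli-recurrence : ∀ m → sumℚ (suc (suc m)) (λ j → ℕ→ℚ (suc (suc m) C j) * bernoulli j) ≡ 0ℚ
bernoulli-recurrence m = begin
  S + ℕ→ℚ (suc (suc m) C suc m) * bernoulli (suc m)
    ≡⟨ cong₂ (λ c b → S + ℕ→ℚ c * b) ([1+n]C[n]≡1+n (suc m)) (proj₂ bernoulli-defining m) ⟩
  S + ℕ→ℚ (suc (suc m)) * - (1/suc (suc m) * sumℚ (suc m) (λ j → ℕ→ℚ (suc (suc m) C j) * earlier m j))
    ≡⟨ cong (λ s → S + ℕ→ℚ (suc (suc m)) * - (1/suc (suc m) * s)) earlier-sum ⟩
  S + ℕ→ℚ (suc (suc m)) * - (1/suc (suc m) * S)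
    ≡⟨ solve 3 (λ n u s → s :+ n :* (:- (u :* s)) := s :- (u :* n) :* s) refl (ℕ→ℚ (suc (suc m))) (1/suc (suc m)) S ⟩
  S - (1/suc (suc m) * ℕ→ℚ (suc (suc m))) * S
    ≡⟨ cong (λ c → S - c * S) (1/suc-inverse (suc m)) ⟩
  S - 1ℚ * S
    ≡⟨ solve 1 (λ s → s :- con 1ℚ :* s := con 0ℚ) refl S ⟩
  0ℚ  ∎
  where
  open ≡-Reasoning
  S : ℚ
  S = sumℚ (suc m) (λ j → ℕ→ℚ (suc (suc m) C j) * bernoulli j)
  earlier-sum : sumℚ (suc m) (λ j → ℕ→ℚ (suc (suc m) C j) * earlier m j) ≡ S
  earlier-sum = sumℚ-cong (suc m) λ j j<1+m →
    cong (ℕ→ℚ (suc (suc m) C j) *_) (trans (earlier≡lookup₀ m j) (lookup₀-reverse-bernList m j (ℕP.≤-pred j<1+m)))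

powerSum-bernoulli-binomial : ∀ N m →
  sumℚ (suc (suc m)) (λ k → ℕ→ℚ (suc (suc m) C k) * (powerSum N k - ℕ→ℚ N * bernoulli k)) ≡ ℕ→ℚ (N ^ suc (suc m))
powerSum-bernoulli-binomial N m = begin
  sumℚ (suc (suc m)) (λ k → c k * (powerSum N k - ℕ→ℚ N * bernoulli k))
    ≡⟨ sumℚ-cong (suc (suc m)) (λ k _ → solve 4 (λ c s n b → c :* (s :- n :* b) := c :* s :- n :* (c :* b)) refl (c k) (powerSum N k) (ℕ→ℚ N) (bernoulli k)) ⟩
  sumℚ (suc (suc m)) (λ k → c k * powerSum N k - ℕ→ℚ N * (c k * bernoulli k))
    ≡⟨ sumℚ-- (suc (suc m)) _ _ ⟩
  sumℚ (suc (suc m)) (λ k → c k * powerSum N k) - sumℚ (suc (suc m)) (λ k → ℕ→ℚ N * (c k * bernoulli k))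
    ≡⟨ cong₂ _-_ (powerSum-binomial N (suc m)) (trans (sumℚ-*ˡ (suc (suc m)) (ℕ→ℚ N) _) (cong (ℕ→ℚ N *_) (bernoulli-recurrence m))) ⟩
  ℕ→ℚ (N ^ suc (suc m)) - ℕ→ℚ N * 0ℚ
    ≡⟨ solve 2 (λ a n → a :- n :* con 0ℚ := a) refl (ℕ→ℚ (N ^ suc (suc m))) (ℕ→ℚ N) ⟩
  ℕ→ℚ (N ^ suc (suc m))  ∎
  where
  open ≡-Reasoning
  c : ℕ → ℚ
  c k = ℕ→ℚ (suc (suc m) C k)

-- σ N k is the k-th elementary symmetric function of 0, 1, …, N - 1; the factor 0 is harmless
-- and makes the power sums those of powerSum N.
σ : ℕ → ℕ → ℚ
σ _       zero    = 1ℚ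
σ zero    (suc k) = 0ℚ
σ (suc N) (suc k) = σ N (suc k) + ℕ→ℚ N * σ N k

sign : ℕ → ℚ
sign zero    = 1ℚ
sign (suc j) = - sign j

sign-odd : ∀ t → sign (suc (t ℕ.+ t)) ≡ - 1ℚ
sign-odd zero    = refl
sign-odd (suc t) = begin
  - - sign (t ℕ.+ suc t)    ≡⟨ cong (λ j → - - sign j) (ℕP.+-suc t t) ⟩
  - - - sign (t ℕ.+ t)      ≡⟨ solve 1 (λ x → :- (:- x) := x) refl (- sign (t ℕ.+ t)) ⟩
  - sign (t ℕ.+ t)          ≡⟨ sign-odd t ⟩
  - 1ℚ                      ∎
  where open ≡-Reasoning

_⊛_ : (ℕ → ℚ) → (ℕ → ℚ) → ℕ → ℚ
(a ⊛ b) k = sumℚ (suc k) (λ j → a j * b (k ∸ j))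

shift : (ℕ → ℚ) → ℕ → ℚ
shift b zero    = 0ℚ
shift b (suc k) = b k

⊛-congˡ : ∀ {a a'} b → (∀ j → a j ≡ a' j) → ∀ k → (a ⊛ b) k ≡ (a' ⊛ b) k
⊛-congˡ b a≡a' k = sumℚ-cong (suc k) (λ j _ → cong (_* b (k ∸ j)) (a≡a' j))

⊛-shift : ∀ a b k → (a ⊛ shift b) k ≡ shift (a ⊛ b) k
⊛-shift a b zero    = trans (ℚP.+-identityˡ _) (ℚP.*-zeroʳ (a 0))
⊛-shift a b (suc k) = begin
  sumℚ (suc k) (λ j → a j * shift b (suc k ∸ j)) + a (suc k) * shift b (suc k ∸ suc k)
    ≡⟨ cong₂ _+_ (sumℚ-cong (suc k) λ j j<1+k → cong (λ i → a j * shift b i) (ℕP.+-∸-assoc 1 (ℕP.≤-pred j<1+k)))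
                 (cong (λ i → a (suc k) * shift b i) (ℕP.n∸n≡0 k)) ⟩
  (a ⊛ b) k + a (suc k) * 0ℚ
    ≡⟨ trans (cong (λ s → (a ⊛ b) k + s) (ℚP.*-zeroʳ (a (suc k)))) (ℚP.+-identityʳ _) ⟩
  (a ⊛ b) k  ∎
  where open ≡-Reasoning

⊛-linearʳ : ∀ a b c x k → (a ⊛ (λ j → b j + x * c j)) k ≡ (a ⊛ b) k + x * (a ⊛ c) k
⊛-linearʳ a b c x k = begin
  sumℚ (suc k) (λ j → a j * (b (k ∸ j) + x * c (k ∸ j)))
    ≡⟨ sumℚ-cong (suc k) (λ j _ → solve 4 (λ a b x c → a :* (b :+ x :* c) := a :* b :+ x :* (a :* c)) refl (a j) (b (k ∸ j)) x (c (k ∸ j))) ⟩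
  sumℚ (suc k) (λ j → a j * b (k ∸ j) + x * (a j * c (k ∸ j)))
    ≡⟨ sumℚ-+ (suc k) _ _ ⟩
  (a ⊛ b) k + sumℚ (suc k) (λ j → x * (a j * c (k ∸ j)))
    ≡⟨ cong (λ s → (a ⊛ b) k + s) (sumℚ-*ˡ (suc k) x _) ⟩
  (a ⊛ b) k + x * (a ⊛ c) k  ∎
  where open ≡-Reasoning

⊛-+ˡ : ∀ a b c k → ((λ j → a j + b j) ⊛ c) k ≡ (a ⊛ c) k + (b ⊛ c) k
⊛-+ˡ a b c k = trans (sumℚ-cong (suc k) (λ j _ → ℚP.*-distribʳ-+ (c (k ∸ j)) (a j) (b j))) (sumℚ-+ (suc k) _ _)

signedPowerSum : ℕ → ℕ → ℚ
signedPowerSum N j = sign j * powerSum N (suc j)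

alternatingPowers : ℕ → ℕ → ℚ
alternatingPowers x j = sign j * ℕ→ℚ (x ^ suc j)

alternatingPowers-suc : ∀ x j → alternatingPowers x (suc j) ≡ - (ℕ→ℚ x * alternatingPowers x j)
alternatingPowers-suc x j = trans (cong (- sign j *_) (ℕ→ℚ-* x (x ^ suc j)))
  (solve 3 (λ s m y → (:- s) :* (m :* y) := :- (m :* (s :* y))) refl (sign j) (ℕ→ℚ x) (ℕ→ℚ (x ^ suc j)))

⊛-alternatingPowers : ∀ x c k → (alternatingPowers x ⊛ c) k + ℕ→ℚ x * shift (alternatingPowers x ⊛ c) k ≡ ℕ→ℚ x * c k
⊛-alternatingPowers x c zero = begin
  (0ℚ + alternatingPowers x 0 * c 0) + ℕ→ℚ x * 0ℚ  ≡⟨ cong₂ (λ y z → (0ℚ + y * c 0) + z) (trans (ℚP.*-identityˡ _) (cong ℕ→ℚ (ℕP.*-identityʳ x))) (ℚP.*-zeroʳ (ℕ→ℚ x)) ⟩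
  (0ℚ + ℕ→ℚ x * c 0) + 0ℚ        ≡⟨ trans (ℚP.+-identityʳ _) (ℚP.+-identityˡ _) ⟩
  ℕ→ℚ x * c 0                    ∎
  where open ≡-Reasoning
⊛-alternatingPowers x c (suc k) = begin
  (alternatingPowers x ⊛ c) (suc k) + X * (alternatingPowers x ⊛ c) k
    ≡⟨ cong (_+ X * (alternatingPowers x ⊛ c) k) (sumℚ-unshift (suc k) (λ j → alternatingPowers x j * c (suc k ∸ j))) ⟩
  (alternatingPowers x 0 * c (suc k) + sumℚ (suc k) (λ j → alternatingPowers x (suc j) * c (k ∸ j))) + X * (alternatingPowers x ⊛ c) k
    ≡⟨ cong₂ (λ y z → (y * c (suc k) + z) + X * (alternatingPowers x ⊛ c) k) head tail ⟩
  (X * c (suc k) + - (X * (alternatingPowers x ⊛ c) k)) + X * (alternatingPowers x ⊛ c) k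
    ≡⟨ solve 3 (λ m y z → (m :* y :+ (:- (m :* z))) :+ m :* z := m :* y) refl X (c (suc k)) ((alternatingPowers x ⊛ c) k) ⟩
  X * c (suc k)  ∎
  where
  open ≡-Reasoning
  X : ℚ
  X = ℕ→ℚ x
  head : alternatingPowers x 0 ≡ X
  head = trans (ℚP.*-identityˡ _) (cong ℕ→ℚ (ℕP.*-identityʳ x))
  tail : sumℚ (suc k) (λ j → alternatingPowers x (suc j) * c (k ∸ j)) ≡ - (X * (alternatingPowers x ⊛ c) k)
  tail = begin
    sumℚ (suc k) (λ j → alternatingPowers x (suc j) * c (k ∸ j))
      ≡⟨ sumℚ-cong (suc k) (λ j _ → trans (cong (_* c (k ∸ j)) (alternatingPowers-suc x j))
           (solve 3 (λ m y z → (:- (m :* y)) :* z := :- (m :* (y :* z))) refl X (alternatingPowers x j) (c (k ∸ j)))) ⟩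
    sumℚ (suc k) (λ j → - (X * (alternatingPowers x j * c (k ∸ j))))
      ≡⟨ trans (sumℚ-neg (suc k) _) (cong -_ (sumℚ-*ˡ (suc k) X _)) ⟩
    - (X * (alternatingPowers x ⊛ c) k)  ∎

newton-identity : ∀ N k → ℕ→ℚ (suc k) * σ N (suc k) ≡ (signedPowerSum N ⊛ σ N) k
newton-identity zero k = begin
  ℕ→ℚ (suc k) * 0ℚ  ≡⟨ ℚP.*-zeroʳ (ℕ→ℚ (suc k)) ⟩
  0ℚ                ≡⟨ sumℚ-0 (suc k) ⟨
  sumℚ (suc k) (λ _ → 0ℚ)
    ≡⟨ sumℚ-cong (suc k) (λ j _ → sym (trans (cong (_* σ 0 (k ∸ j)) (ℚP.*-zeroʳ (sign j))) (ℚP.*-zeroˡ (σ 0 (k ∸ j))))) ⟩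
  (signedPowerSum 0 ⊛ σ 0) k  ∎
  where open ≡-Reasoning
newton-identity (suc N) k = begin
  ℕ→ℚ (suc k) * (σ N (suc k) + X * σ N k)
    ≡⟨ solve 4 (λ a b x c → a :* (b :+ x :* c) := a :* b :+ x :* (a :* c)) refl (ℕ→ℚ (suc k)) (σ N (suc k)) X (σ N k) ⟩
  ℕ→ℚ (suc k) * σ N (suc k) + X * (ℕ→ℚ (suc k) * σ N k)
    ≡⟨ cong₂ (λ u v → u + X * v) (newton-identity N k) (lower-degree k) ⟩
  (s ⊛ σ N) k + X * (σ N k + shift (s ⊛ σ N) k)
    ≡⟨ solve 4 (λ a x c d → a :+ x :* (c :+ d) := (a :+ x :* d) :+ x :* c) refl ((s ⊛ σ N) k) X (σ N k) (shift (s ⊛ σ N) k) ⟩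
  ((s ⊛ σ N) k + X * shift (s ⊛ σ N) k) + X * σ N k
    ≡⟨ cong₂ _+_ (sym (split s)) (sym (⊛-alternatingPowers N (σ N) k)) ⟩
  (s ⊛ σ′) k + ((g ⊛ σ N) k + X * shift (g ⊛ σ N) k)
    ≡⟨ cong (λ z → (s ⊛ σ′) k + z) (sym (split g)) ⟩
  (s ⊛ σ′) k + (g ⊛ σ′) k
    ≡⟨ sym (⊛-+ˡ s g σ′ k) ⟩
  ((λ j → s j + g j) ⊛ σ′) k
    ≡⟨ ⊛-congˡ σ′ (λ j → sym (ℚP.*-distribˡ-+ (sign j) _ _)) k ⟩
  (signedPowerSum (suc N) ⊛ σ′) k
    ≡⟨ sumℚ-cong (suc k) (λ j _ → cong (signedPowerSum (suc N) j *_) (sym (σ-suc (k ∸ j)))) ⟩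
  (signedPowerSum (suc N) ⊛ σ (suc N)) k  ∎
  where
  open ≡-Reasoning
  X : ℚ
  X = ℕ→ℚ N
  s : ℕ → ℚ
  s = signedPowerSum N
  g : ℕ → ℚ
  g = alternatingPowers N
  σ′ : ℕ → ℚ
  σ′ j = σ N j + X * shift (σ N) j
  σ-suc : ∀ j → σ (suc N) j ≡ σ′ j
  σ-suc zero    = sym (trans (cong (λ z → 1ℚ + z) (ℚP.*-zeroʳ X)) (ℚP.+-identityʳ 1ℚ))
  σ-suc (suc j) = refl
  lower-degree : ∀ k → ℕ→ℚ (suc k) * σ N k ≡ σ N k + shift (s ⊛ σ N) k
  lower-degree zero    = trans (ℚP.*-identityˡ (σ N 0)) (sym (ℚP.+-identityʳ (σ N 0)))
  lower-degree (suc k) = begin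
    ℕ→ℚ (suc (suc k)) * σ N (suc k)            ≡⟨ cong (_* σ N (suc k)) (ℕ→ℚ-suc (suc k)) ⟩
    (ℕ→ℚ (suc k) + 1ℚ) * σ N (suc k)           ≡⟨ solve 2 (λ a c → (a :+ con 1ℚ) :* c := c :+ a :* c) refl (ℕ→ℚ (suc k)) (σ N (suc k)) ⟩
    σ N (suc k) + ℕ→ℚ (suc k) * σ N (suc k)    ≡⟨ cong (λ z → σ N (suc k) + z) (newton-identity N k) ⟩
    σ N (suc k) + (s ⊛ σ N) k                  ∎
  split : ∀ a → (a ⊛ σ′) k ≡ (a ⊛ σ N) k + X * shift (a ⊛ σ N) k
  split a = trans (⊛-linearʳ a (σ N) (shift (σ N)) X k) (cong (λ z → (a ⊛ σ N) k + X * z) (⊛-shift a (σ N) k))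

σ-vanishes : ∀ N d → σ (suc N) (suc (N ℕ.+ d)) ≡ 0ℚ
σ-vanishes zero    d = trans (ℚP.+-identityˡ _) (ℚP.*-zeroˡ (σ 0 d))
σ-vanishes (suc N) d = begin
  σ (suc N) (suc (suc N ℕ.+ d)) + ℕ→ℚ (suc N) * σ (suc N) (suc (N ℕ.+ d))
    ≡⟨ cong₂ (λ k z → σ (suc N) (suc k) + ℕ→ℚ (suc N) * z) (sym (ℕP.+-suc N d)) (σ-vanishes N d) ⟩
  σ (suc N) (suc (N ℕ.+ suc d)) + ℕ→ℚ (suc N) * 0ℚ
    ≡⟨ cong₂ _+_ (σ-vanishes N (suc d)) (ℚP.*-zeroʳ (ℕ→ℚ (suc N))) ⟩
  0ℚ + 0ℚ  ≡⟨⟩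
  0ℚ  ∎
  where open ≡-Reasoning

σ-top : ∀ N → σ (suc N) N ≡ ℕ→ℚ (N !)
σ-top zero    = refl
σ-top (suc N) = begin
  σ (suc N) (suc N) + ℕ→ℚ (suc N) * σ (suc N) N  ≡⟨ cong₂ (λ a b → a + ℕ→ℚ (suc N) * b) (subst (λ k → σ (suc N) (suc k) ≡ 0ℚ) (ℕP.+-identityʳ N) (σ-vanishes N 0)) (σ-top N) ⟩
  0ℚ + ℕ→ℚ (suc N) * ℕ→ℚ (N !)                   ≡⟨ trans (ℚP.+-identityˡ _) (sym (ℕ→ℚ-* (suc N) (N !))) ⟩
  ℕ→ℚ (suc N !)                                  ∎
  where open ≡-Reasoning

H₁₁ : ℕ → ℚ
H₁₁ N = sumℚ N (λ i → H 1 i * 1/suc i)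

σ-top-1 : ∀ N → σ (suc (suc N)) N ≡ ℕ→ℚ (suc N !) * H 1 (suc N)
σ-top-1 zero    = refl
σ-top-1 (suc N) = begin
  σ (suc (suc N)) (suc N) + X * σ (suc (suc N)) N  ≡⟨ cong₂ (λ a b → a + X * b) (σ-top (suc N)) (σ-top-1 N) ⟩
  F + X * (F * Hs)                                  ≡⟨ solve 3 (λ X F H → F :+ X :* (F :* H) := X :* F :* H :+ con 1ℚ :* F) refl X F Hs ⟩
  X * F * Hs + 1ℚ * F                               ≡⟨ cong (λ c → X * F * Hs + c * F) (1/suc-inverse (suc N)) ⟨
  X * F * Hs + (u * X) * F                          ≡⟨ solve 4 (λ X F H u → X :* F :* H :+ (u :* X) :* F := (X :* F) :* (H :+ u :* con 1ℚ)) refl X F Hs u ⟩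
  (X * F) * H 1 (suc (suc N))                       ≡⟨ cong (_* H 1 (suc (suc N))) (ℕ→ℚ-* (suc (suc N)) (suc N !)) ⟨
  ℕ→ℚ (suc (suc N) !) * H 1 (suc (suc N))           ∎
  where
  open ≡-Reasoning
  X F Hs u : ℚ
  X = ℕ→ℚ (suc (suc N))
  F = ℕ→ℚ (suc N !)
  Hs = H 1 (suc N)
  u = 1/suc (suc N)

σ-top-2 : ∀ N → σ (suc (suc (suc N))) N ≡ ℕ→ℚ (suc (suc N) !) * H₁₁ (suc (suc N))
σ-top-2 zero    = refl
σ-top-2 (suc N) = begin
  σ (suc (suc (suc N))) (suc N) + X * σ (suc (suc (suc N))) N  ≡⟨ cong₂ (λ a b → a + X * b) (σ-top-1 (suc N)) (σ-top-2 N) ⟩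
  F * Hs + X * (F * h)                                          ≡⟨ solve 4 (λ X F H h → F :* H :+ X :* (F :* h) := X :* F :* h :+ con 1ℚ :* (F :* H)) refl X F Hs h ⟩
  X * F * h + 1ℚ * (F * Hs)                                     ≡⟨ cong (λ c → X * F * h + c * (F * Hs)) (1/suc-inverse (suc (suc N))) ⟨
  X * F * h + (u * X) * (F * Hs)                                ≡⟨ solve 5 (λ X F H h u → X :* F :* h :+ (u :* X) :* (F :* H) := (X :* F) :* (h :+ H :* u)) refl X F Hs h u ⟩
  (X * F) * H₁₁ (suc (suc (suc N)))                             ≡⟨ cong (_* H₁₁ (suc (suc (suc N)))) (ℕ→ℚ-* (suc (suc (suc N))) (suc (suc N) !)) ⟨
  ℕ→ℚ (suc (suc (suc N)) !) * H₁₁ (suc (suc (suc N)))           ∎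
  where
  open ≡-Reasoning
  X F Hs h u : ℚ
  X = ℕ→ℚ (suc (suc (suc N)))
  F = ℕ→ℚ (suc (suc N) !)
  Hs = H 1 (suc (suc N))
  h = H₁₁ (suc (suc N))
  u = 1/suc (suc (suc N))

H₁-square : ∀ N → H 1 N * H 1 N ≡ H 2 N + ℕ→ℚ 2 * H₁₁ N
H₁-square zero    = refl
H₁-square (suc N) = begin
  (H 1 N + u * 1ℚ) * (H 1 N + u * 1ℚ)
    ≡⟨ solve 2 (λ h u → (h :+ u :* con 1ℚ) :* (h :+ u :* con 1ℚ) := h :* h :+ (u :* (u :* con 1ℚ) :+ con (ℕ→ℚ 2) :* (h :* u))) refl (H 1 N) u ⟩
  H 1 N * H 1 N + (u * (u * 1ℚ) + ℕ→ℚ 2 * (H 1 N * u))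
    ≡⟨ cong (_+ (u * (u * 1ℚ) + ℕ→ℚ 2 * (H 1 N * u))) (H₁-square N) ⟩
  (H 2 N + ℕ→ℚ 2 * H₁₁ N) + (u * (u * 1ℚ) + ℕ→ℚ 2 * (H 1 N * u))
    ≡⟨ solve 4 (λ a f u b → (a :+ con (ℕ→ℚ 2) :* f) :+ (u :+ con (ℕ→ℚ 2) :* b) := (a :+ u) :+ con (ℕ→ℚ 2) :* (f :+ b)) refl (H 2 N) (H₁₁ N) (u * (u * 1ℚ)) (H 1 N * u) ⟩
  H 2 (suc N) + ℕ→ℚ 2 * H₁₁ (suc N)  ∎
  where
  open ≡-Reasoning
  u : ℚ
  u = 1/suc N

module Reflection (N : ℕ) where
  P : ℚ
  P = ℕ→ℚ (suc N)

  u v : ℕ → ℚ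
  u i = 1/suc i
  v i = 1/suc (N ∸ suc i)

  pair-relation : ∀ i → i ℕ.< N → P * u i * v i - (u i + v i) ≡ 0ℚ
  pair-relation i i<N = begin
    P * u i * v i - (u i + v i)
      ≡⟨ cong (λ z → z * u i * v i - (u i + v i)) (trans (cong ℕ→ℚ split) (ℕ→ℚ-+ (suc i) (suc (N ∸ suc i)))) ⟩
    (a + b) * u i * v i - (u i + v i)
      ≡⟨ solve 4 (λ a b u v → (a :+ b) :* u :* v :- (u :+ v) := (u :* a :- con 1ℚ) :* v :+ (v :* b :- con 1ℚ) :* u) refl a b (u i) (v i) ⟩
    (u i * a - 1ℚ) * v i + (v i * b - 1ℚ) * u i
      ≡⟨ cong₂ (λ x y → (x - 1ℚ) * v i + (y - 1ℚ) * u i) (1/suc-inverse i) (1/suc-inverse (N ∸ suc i)) ⟩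
    (1ℚ - 1ℚ) * v i + (1ℚ - 1ℚ) * u i
      ≡⟨ solve 2 (λ u v → (con 1ℚ :- con 1ℚ) :* v :+ (con 1ℚ :- con 1ℚ) :* u := con 0ℚ) refl (u i) (v i) ⟩
    0ℚ  ∎
    where
    open ≡-Reasoning
    a b : ℚ
    a = ℕ→ℚ (suc i)
    b = ℕ→ℚ (suc (N ∸ suc i))
    split : suc N ≡ suc i ℕ.+ suc (N ∸ suc i)
    split = sym (cong suc (trans (ℕP.+-suc i (N ∸ suc i)) (ℕP.m+[n∸m]≡n i<N)))

  R₁ R₃ : ℚ
  R₁ = sumℚ N (λ i → u i * (u i * (u i * v i)))
  R₃ = sumℚ N (λ i → u i * v i * (u i * u i - u i * v i + v i * v i))

  H₁-reflection : ℕ→ℚ 2 * H 1 N ≡ - (P * H 2 N) - P * P * H 3 N + P * P * P * R₁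
  H₁-reflection = begin
    ℕ→ℚ 2 * H 1 N
      ≡⟨ sumℚ-reflect-pairs N (λ i → inv-pow i 1) ⟩
    sumℚ N (λ i → u i * 1ℚ + v i * 1ℚ)
      ≡⟨ sumℚ-cong N pair ⟩
    sumℚ N (λ i → (- (P * inv-pow i 2) + - (P * P * inv-pow i 3)) + P * P * P * (u i * (u i * (u i * v i))))
      ≡⟨ trans (sumℚ-+ N _ _) (cong₂ _+_ (sumℚ-+ N _ _) (sumℚ-*ˡ N (P * P * P) _)) ⟩
    (sumℚ N (λ i → - (P * inv-pow i 2)) + sumℚ N (λ i → - (P * P * inv-pow i 3))) + P * P * P * R₁
      ≡⟨ cong (λ z → z + P * P * P * R₁) (cong₂ _+_
           (trans (sumℚ-neg N _) (cong -_ (sumℚ-*ˡ N P _))) (trans (sumℚ-neg N _) (cong -_ (sumℚ-*ˡ N (P * P) _)))) ⟩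
    - (P * H 2 N) - P * P * H 3 N + P * P * P * R₁  ∎
    where
    open ≡-Reasoning
    pair : ∀ i → i ℕ.< N → u i * 1ℚ + v i * 1ℚ
      ≡ (- (P * inv-pow i 2) + - (P * P * inv-pow i 3)) + P * P * P * (u i * (u i * (u i * v i)))
    pair i i<N = drop-vanishing-multiple (- (P * P * u i * u i + P * u i + 1ℚ)) _ _ (pair-relation i i<N)
      (solve 3 (λ P u v → u :* con 1ℚ :+ v :* con 1ℚ
          := ((:- (P :* (u :* (u :* con 1ℚ)))) :+ (:- (P :* P :* (u :* (u :* (u :* con 1ℚ)))))) :+ P :* P :* P :* (u :* (u :* (u :* v)))
             :+ (P :* u :* v :- (u :+ v)) :* (:- (P :* P :* u :* u :+ P :* u :+ con 1ℚ))) refl P (u i) (v i))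

  H₃-reflection : ℕ→ℚ 2 * H 3 N ≡ P * R₃
  H₃-reflection = begin
    ℕ→ℚ 2 * H 3 N
      ≡⟨ sumℚ-reflect-pairs N (λ i → inv-pow i 3) ⟩
    sumℚ N (λ i → inv-pow i 3 + inv-pow (N ∸ suc i) 3)
      ≡⟨ sumℚ-cong N pair ⟩
    sumℚ N (λ i → P * (u i * v i * (u i * u i - u i * v i + v i * v i)))
      ≡⟨ sumℚ-*ˡ N P _ ⟩
    P * R₃  ∎
    where
    open ≡-Reasoning
    pair : ∀ i → i ℕ.< N → inv-pow i 3 + inv-pow (N ∸ suc i) 3 ≡ P * (u i * v i * (u i * u i - u i * v i + v i * v i))
    pair i i<N = drop-vanishing-multiple (- (u i * u i - u i * v i + v i * v i)) _ _ (pair-relation i i<N)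
      (solve 3 (λ P u v → u :* (u :* (u :* con 1ℚ)) :+ v :* (v :* (v :* con 1ℚ))
          := P :* (u :* v :* (u :* u :- u :* v :+ v :* v)) :+ (P :* u :* v :- (u :+ v)) :* (:- (u :* u :- u :* v :+ v :* v))) refl P (u i) (v i))

inv-pow-lower : ∀ i m → inv-pow i m ≡ ℕ→ℚ (suc i) * inv-pow i (suc m)
inv-pow-lower i m = begin
  inv-pow i m                                ≡⟨ ℚP.*-identityˡ _ ⟨
  1ℚ * inv-pow i m                           ≡⟨ cong (_* inv-pow i m) (1/suc-inverse i) ⟨
  (1/suc i * ℕ→ℚ (suc i)) * inv-pow i m      ≡⟨ solve 3 (λ u X w → (u :* X) :* w := X :* (u :* w)) refl (1/suc i) (ℕ→ℚ (suc i)) (inv-pow i m) ⟩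
  ℕ→ℚ (suc i) * inv-pow i (suc m)            ∎
  where open ≡-Reasoning

weighted-harmonic-sum : ∀ m N →
  ℕ→ℚ 2 * sumℚ (suc N) (λ k → ℕ→ℚ k * H (suc (suc m)) k)
    ≡ ℕ→ℚ (suc N) * ℕ→ℚ N * H (suc (suc m)) N - H m N + H (suc m) N
weighted-harmonic-sum m zero    = refl
weighted-harmonic-sum m (suc N) = begin
  ℕ→ℚ 2 * (S + X * (H′ + w₂))
    ≡⟨ solve 4 (λ S X h w → con (ℕ→ℚ 2) :* (S :+ X :* (h :+ w)) := con (ℕ→ℚ 2) :* S :+ con (ℕ→ℚ 2) :* X :* (h :+ w)) refl S X H′ w₂ ⟩
  ℕ→ℚ 2 * S + ℕ→ℚ 2 * X * (H′ + w₂)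
    ≡⟨ cong (_+ ℕ→ℚ 2 * X * (H′ + w₂)) (weighted-harmonic-sum m N) ⟩
  (X * Y * H′ - H m N + H (suc m) N) + ℕ→ℚ 2 * X * (H′ + w₂)
    ≡⟨ step (H m N) (H (suc m) N) (ℕ→ℚ-suc N) (ℕ→ℚ-suc (suc N)) (inv-pow-lower N (suc m)) (inv-pow-lower N m) ⟩
  ℕ→ℚ (suc (suc N)) * X * (H′ + w₂) - (H m N + inv-pow N m) + (H (suc m) N + inv-pow N (suc m))  ∎
  where
  open ≡-Reasoning
  S X Y H′ w₂ : ℚ
  S = sumℚ (suc N) (λ k → ℕ→ℚ k * H (suc (suc m)) k)
  X = ℕ→ℚ (suc N)
  Y = ℕ→ℚ N
  H′ = H (suc (suc m)) N
  w₂ = inv-pow N (suc (suc m))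
  step : ∀ a b {X X′ w₁ w₀} → X ≡ Y + 1ℚ → X′ ≡ X + 1ℚ → w₁ ≡ X * w₂ → w₀ ≡ X * w₁ →
    (X * Y * H′ - a + b) + ℕ→ℚ 2 * X * (H′ + w₂) ≡ X′ * X * (H′ + w₂) - (a + w₀) + (b + w₁)
  step a b refl refl refl refl = solve 5 (λ Y h w a b →
      ((Y :+ con 1ℚ) :* Y :* h :- a :+ b) :+ con (ℕ→ℚ 2) :* (Y :+ con 1ℚ) :* (h :+ w)
      := (Y :+ con 1ℚ :+ con 1ℚ) :* (Y :+ con 1ℚ) :* (h :+ w) :- (a :+ (Y :+ con 1ℚ) :* ((Y :+ con 1ℚ) :* w)) :+ (b :+ (Y :+ con 1ℚ) :* w))
    refl Y H′ w₂ a b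

module Localisation (p : ℕ) (p-prime : Prime p) where

  instance
    p-nonZero : ℕ.NonZero p
    p-nonZero = prime⇒nonZero p-prime

  p∤1 : ¬ p ∣ 1
  p∤1 p∣1 = ℕ.nonTrivial⇒≢1 ⦃ prime⇒nonTrivial p-prime ⦄ (ℕ∣.∣1⇒≡1 p∣1)

  p∤* : ∀ {a b} → ¬ p ∣ a → ¬ p ∣ b → ¬ p ∣ a ℕ.* b
  p∤* p∤a p∤b p∣ab = [ p∤a , p∤b ]′ (euclidsLemma _ _ p-prime p∣ab)

  p∤1+n : ∀ {n} → suc n ℕ.< p → ¬ p ∣ suc n
  p∤1+n 1+n<p p∣1+n = ℕP.<⇒≱ 1+n<p (ℕ∣.∣⇒≤ p∣1+n)

  record Integral (x : ℚ) : Set where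
    constructor integral
    field
      denominator   : ℕ
      numerator     : ℤ
      p∤denominator : ¬ p ∣ denominator
      clears        : x * ℕ→ℚ denominator ≡ ℤ→ℚ numerator

  Integral-ℤ→ℚ : ∀ a → Integral (ℤ→ℚ a)
  Integral-ℤ→ℚ a = integral 1 a p∤1 (ℚP.*-identityʳ (ℤ→ℚ a))

  Integral-ℕ→ℚ : ∀ n → Integral (ℕ→ℚ n)
  Integral-ℕ→ℚ n = Integral-ℤ→ℚ (+ n)

  Integral-+ : ∀ {x y} → Integral x → Integral y → Integral (x + y)
  Integral-+ {x} {y} (integral d a p∤d xd≡a) (integral d′ b p∤d′ yd′≡b) =
    integral (d ℕ.* d′) (a ℤ.* + d′ ℤ.+ b ℤ.* + d) (p∤* p∤d p∤d′) (begin
      (x + y) * ℕ→ℚ (d ℕ.* d′)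
        ≡⟨ cong ((x + y) *_) (ℕ→ℚ-* d d′) ⟩
      (x + y) * (ℕ→ℚ d * ℕ→ℚ d′)
        ≡⟨ solve 4 (λ x y D E → (x :+ y) :* (D :* E) := (x :* D) :* E :+ (y :* E) :* D) refl x y (ℕ→ℚ d) (ℕ→ℚ d′) ⟩
      (x * ℕ→ℚ d) * ℕ→ℚ d′ + (y * ℕ→ℚ d′) * ℕ→ℚ d
        ≡⟨ cong₂ (λ s t → s * ℕ→ℚ d′ + t * ℕ→ℚ d) xd≡a yd′≡b ⟩
      ℤ→ℚ a * ℤ→ℚ (+ d′) + ℤ→ℚ b * ℤ→ℚ (+ d)
        ≡⟨ trans (ℤ→ℚ-+ (a ℤ.* + d′) (b ℤ.* + d)) (cong₂ _+_ (ℤ→ℚ-* a (+ d′)) (ℤ→ℚ-* b (+ d))) ⟨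
      ℤ→ℚ (a ℤ.* + d′ ℤ.+ b ℤ.* + d)  ∎)
    where open ≡-Reasoning

  Integral-* : ∀ {x y} → Integral x → Integral y → Integral (x * y)
  Integral-* {x} {y} (integral d a p∤d xd≡a) (integral d′ b p∤d′ yd′≡b) =
    integral (d ℕ.* d′) (a ℤ.* b) (p∤* p∤d p∤d′) (begin
      (x * y) * ℕ→ℚ (d ℕ.* d′)      ≡⟨ cong ((x * y) *_) (ℕ→ℚ-* d d′) ⟩
      (x * y) * (ℕ→ℚ d * ℕ→ℚ d′)    ≡⟨ solve 4 (λ x y D E → (x :* y) :* (D :* E) := (x :* D) :* (y :* E)) refl x y (ℕ→ℚ d) (ℕ→ℚ d′) ⟩
      (x * ℕ→ℚ d) * (y * ℕ→ℚ d′)    ≡⟨ cong₂ _*_ xd≡a yd′≡b ⟩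
      ℤ→ℚ a * ℤ→ℚ b                 ≡⟨ ℤ→ℚ-* a b ⟨
      ℤ→ℚ (a ℤ.* b)                 ∎)
    where open ≡-Reasoning

  Integral-neg : ∀ {x} → Integral x → Integral (- x)
  Integral-neg {x} (integral d a p∤d xd≡a) = integral d (ℤ.- a) p∤d
    (trans (sym (ℚP.neg-distribˡ-* x (ℕ→ℚ d))) (trans (cong -_ xd≡a) (sym (ℤ→ℚ-neg a))))

  Integral-- : ∀ {x y} → Integral x → Integral y → Integral (x - y)
  Integral-- ∫x ∫y = Integral-+ ∫x (Integral-neg ∫y)

  Integral-1/suc : ∀ {n} → ¬ p ∣ suc n → Integral (1/suc n)
  Integral-1/suc {n} p∤1+n = integral (suc n) (+ 1) p∤1+n (1/suc-inverse n)

  Integral-sum : ∀ n {f : ℕ → ℚ} → (∀ i → i ℕ.< n → Integral (f i)) → Integral (sumℚ n f)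
  Integral-sum zero    ∫f = Integral-ℕ→ℚ 0
  Integral-sum (suc n) ∫f = Integral-+ (Integral-sum n (λ i i<n → ∫f i (ℕP.m<n⇒m<1+n i<n))) (∫f n ℕP.≤-refl)

  Integral-inv-pow : ∀ {i} m → suc i ℕ.< p → Integral (inv-pow i m)
  Integral-inv-pow zero    _      = Integral-ℕ→ℚ 1
  Integral-inv-pow (suc m) 1+i<p = Integral-* (Integral-1/suc (p∤1+n 1+i<p)) (Integral-inv-pow m 1+i<p)

  Integral-H : ∀ m {N} → N ℕ.< p → Integral (H m N)
  Integral-H m {N} N<p = Integral-sum N (λ i i<N → Integral-inv-pow m (ℕP.≤-<-trans i<N N<p))

  record Divisible (e : ℕ) (x : ℚ) : Set where
    constructor divisible
    field
      quotient          : ℚ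
      integral-quotient : Integral quotient
      factorisation     : x ≡ ℕ→ℚ (p ^ e) * quotient

  Divisible-0 : ∀ e → Divisible e 0ℚ
  Divisible-0 e = divisible 0ℚ (Integral-ℕ→ℚ 0) (sym (ℚP.*-zeroʳ (ℕ→ℚ (p ^ e))))

  Integral⇒Divisible⁰ : ∀ {x} → Integral x → Divisible 0 x
  Integral⇒Divisible⁰ {x} ∫x = divisible x ∫x (sym (ℚP.*-identityˡ x))

  Divisible⇒Integral : ∀ {e x} → Divisible e x → Integral x
  Divisible⇒Integral {e} (divisible z ∫z refl) = Integral-* (Integral-ℕ→ℚ (p ^ e)) ∫z

  Divisible-+ : ∀ {e x y} → Divisible e x → Divisible e y → Divisible e (x + y)
  Divisible-+ {e} (divisible z ∫z refl) (divisible w ∫w refl) =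
    divisible (z + w) (Integral-+ ∫z ∫w) (sym (ℚP.*-distribˡ-+ (ℕ→ℚ (p ^ e)) z w))

  Divisible-neg : ∀ {e x} → Divisible e x → Divisible e (- x)
  Divisible-neg {e} (divisible z ∫z refl) = divisible (- z) (Integral-neg ∫z) (ℚP.neg-distribʳ-* (ℕ→ℚ (p ^ e)) z)

  Divisible-- : ∀ {e x y} → Divisible e x → Divisible e y → Divisible e (x - y)
  Divisible-- p∣x p∣y = Divisible-+ p∣x (Divisible-neg p∣y)

  Divisible-*ˡ : ∀ {e c x} → Integral c → Divisible e x → Divisible e (c * x)
  Divisible-*ˡ {e} {c} ∫c (divisible z ∫z refl) = divisible (c * z) (Integral-* ∫c ∫z)
    (solve 3 (λ c P z → c :* (P :* z) := P :* (c :* z)) refl c (ℕ→ℚ (p ^ e)) z)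

  Divisible-* : ∀ {e f x y} → Divisible e x → Divisible f y → Divisible (e ℕ.+ f) (x * y)
  Divisible-* {e} {f} (divisible z ∫z refl) (divisible w ∫w refl) = divisible (z * w) (Integral-* ∫z ∫w) (begin
    (ℕ→ℚ (p ^ e) * z) * (ℕ→ℚ (p ^ f) * w)  ≡⟨ solve 4 (λ P Q z w → (P :* z) :* (Q :* w) := (P :* Q) :* (z :* w)) refl (ℕ→ℚ (p ^ e)) (ℕ→ℚ (p ^ f)) z w ⟩
    (ℕ→ℚ (p ^ e) * ℕ→ℚ (p ^ f)) * (z * w)  ≡⟨ cong (_* (z * w)) (trans (cong ℕ→ℚ (ℕP.^-distribˡ-+-* p e f)) (ℕ→ℚ-* (p ^ e) (p ^ f))) ⟨
    ℕ→ℚ (p ^ (e ℕ.+ f)) * (z * w)          ∎)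
    where open ≡-Reasoning

  Divisible-ℕ→ℚ : ∀ {n} → p ∣ n → Divisible 1 (ℕ→ℚ n)
  Divisible-ℕ→ℚ (divides q refl) = divisible (ℕ→ℚ q) (Integral-ℕ→ℚ q)
    (trans (ℕ→ℚ-* q p) (trans (ℚP.*-comm (ℕ→ℚ q) (ℕ→ℚ p)) (cong (λ n → ℕ→ℚ n * ℕ→ℚ q) (sym (ℕP.*-identityʳ p)))))

  Divisible-sum : ∀ {e} n {f : ℕ → ℚ} → (∀ i → i ℕ.< n → Divisible e (f i)) → Divisible e (sumℚ n f)
  Divisible-sum {e} zero    p∣f = Divisible-0 e
  Divisible-sum     (suc n) p∣f = Divisible-+ (Divisible-sum n (λ i i<n → p∣f i (ℕP.m<n⇒m<1+n i<n))) (p∣f n ℕP.≤-refl)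

  Divisible-p* : ∀ {e x} → Divisible e x → Divisible (suc e) (ℕ→ℚ p * x)
  Divisible-p* {e} (divisible z ∫z refl) = divisible z ∫z (begin
    ℕ→ℚ p * (ℕ→ℚ (p ^ e) * z)    ≡⟨ ℚP.*-assoc (ℕ→ℚ p) _ z ⟨
    ℕ→ℚ p * ℕ→ℚ (p ^ e) * z      ≡⟨ cong (_* z) (ℕ→ℚ-* p (p ^ e)) ⟨
    ℕ→ℚ (p ^ suc e) * z          ∎)
    where open ≡-Reasoning

  Integral⇒Divisible-p* : ∀ {x} → Integral x → Divisible 1 (ℕ→ℚ p * x)
  Integral⇒Divisible-p* ∫x = Divisible-p* (Integral⇒Divisible⁰ ∫x)

  Divisible-p^ : ∀ e k → Divisible e (ℕ→ℚ (p ^ (e ℕ.+ k)))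
  Divisible-p^ e k = divisible (ℕ→ℚ (p ^ k)) (Integral-ℕ→ℚ (p ^ k))
    (trans (cong ℕ→ℚ (ℕP.^-distribˡ-+-* p e k)) (ℕ→ℚ-* (p ^ e) (p ^ k)))

  Divisible-weaken : ∀ k {e x} → Divisible (k ℕ.+ e) x → Divisible e x
  Divisible-weaken zero    p∣x = p∣x
  Divisible-weaken (suc k) {e} (divisible z ∫z refl) = Divisible-weaken k (divisible (ℕ→ℚ p * z) (Integral-* (Integral-ℕ→ℚ p) ∫z)
    (trans (cong (_* z) (ℕ→ℚ-* p (p ^ (k ℕ.+ e))))
      (solve 3 (λ P Q z → (P :* Q) :* z := Q :* (P :* z)) refl (ℕ→ℚ p) (ℕ→ℚ (p ^ (k ℕ.+ e))) z)))

  Divisible-cancel-unit : ∀ {e n x} → ¬ p ∣ suc n → Divisible e (ℕ→ℚ (suc n) * x) → Divisible e x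
  Divisible-cancel-unit {n = n} {x} p∤1+n p∣nx =
    subst (Divisible _) (*-inverse-cancelˡ (1/suc n) (ℕ→ℚ (suc n)) x (1/suc-inverse n)) (Divisible-*ˡ (Integral-1/suc p∤1+n) p∣nx)

  Integral-cancel-unit : ∀ {n x} → ¬ p ∣ suc n → Integral (ℕ→ℚ (suc n) * x) → Integral x
  Integral-cancel-unit p∤1+n ∫nx = Divisible⇒Integral (Divisible-cancel-unit {0} p∤1+n (Integral⇒Divisible⁰ ∫nx))

  Divisible-cancel-p : ∀ {e x} → Divisible (suc e) (ℕ→ℚ p * x) → Divisible e x
  Divisible-cancel-p {e} {x} (divisible z ∫z px≡) = divisible z ∫z (begin
    x                                   ≡⟨ *-inverse-cancelˡ u (ℕ→ℚ p) x u*p≡1 ⟨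
    u * (ℕ→ℚ p * x)                     ≡⟨ cong (u *_) px≡ ⟩
    u * (ℕ→ℚ (p ^ suc e) * z)           ≡⟨ cong (λ y → u * (y * z)) (ℕ→ℚ-* p (p ^ e)) ⟩
    u * (ℕ→ℚ p * ℕ→ℚ (p ^ e) * z)       ≡⟨ cong (u *_) (ℚP.*-assoc (ℕ→ℚ p) _ z) ⟩
    u * (ℕ→ℚ p * (ℕ→ℚ (p ^ e) * z))     ≡⟨ *-inverse-cancelˡ u (ℕ→ℚ p) _ u*p≡1 ⟩
    ℕ→ℚ (p ^ e) * z                     ∎)
    where
    open ≡-Reasoning
    u : ℚ
    u = 1/suc (ℕ.pred p)
    u*p≡1 : u * ℕ→ℚ p ≡ 1ℚ
    u*p≡1 = subst (λ n → u * ℕ→ℚ n ≡ 1ℚ) (ℕP.suc-pred p) (1/suc-inverse (ℕ.pred p))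

  p^e∣X*d⇒p^e∣X : ∀ e X d → ¬ p ∣ d → p ^ e ∣ X ℕ.* d → p ^ e ∣ X
  p^e∣X*d⇒p^e∣X zero    X d p∤d _ = ℕ∣.1∣ X
  p^e∣X*d⇒p^e∣X (suc e) X d p∤d p^e⁺∣Xd with euclidsLemma X d p-prime (ℕ∣.∣-trans (ℕ∣.m∣m*n (p ^ e)) p^e⁺∣Xd)
  ... | inj₂ p∣d = contradiction p∣d p∤d
  ... | inj₁ (divides k refl) = subst (p ℕ.* p ^ e ∣_) (ℕP.*-comm p k)
    (ℕ∣.*-monoʳ-∣ p (p^e∣X*d⇒p^e∣X e k d p∤d (ℕ∣.*-cancelˡ-∣ p (subst (p ℕ.* p ^ e ∣_) reassoc p^e⁺∣Xd))))
    where
    reassoc : k ℕ.* p ℕ.* d ≡ p ℕ.* (k ℕ.* d)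
    reassoc = solveℕ 3 (λ k p d → k :*ℕ p :*ℕ d :=ℕ p :*ℕ (k :*ℕ d)) refl k p d

  cross-multiply : ∀ n d-1 c .(cop : Coprime ℤ.∣ n ∣ (suc d-1)) d → mkℚ n d-1 cop * ℕ→ℚ d ≡ ℤ→ℚ c →
    ℤ.∣ n ∣ ℕ.* d ≡ ℤ.∣ c ∣ ℕ.* suc d-1
  cross-multiply n d-1 c cop d eq with UP.≃-trans (UP.≃-sym (UP.*-cong (UP.≃-refl {U.mkℚᵘ n d-1}) (toℚᵘ-ℤ→ℚ (+ d))))
    (UP.≃-trans (UP.≃-sym (ℚP.toℚᵘ-homo-* (mkℚ n d-1 cop) (ℕ→ℚ d))) (UP.≃-trans (ℚP.toℚᵘ-cong eq) (toℚᵘ-ℤ→ℚ c)))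
  ... | U.*≡* e = trans (sym (trans (ℤP.abs-* (n ℤ.* + d) (+ 1)) (trans (cong (ℕ._* 1) (ℤP.abs-* n (+ d))) (ℕP.*-identityʳ _))))
                   (trans (cong ℤ.∣_∣ e) (trans (ℤP.abs-* c _) (cong (ℤ.∣ c ∣ ℕ.*_) (ℕP.*-identityʳ (suc d-1)))))

  Divisible⇒≡[modℚ] : ∀ {e} x y → Divisible e (x - y) → x ≡ y [modℚ p ^ e ]
  Divisible⇒≡[modℚ] {e} x y = lowest-terms (x - y)
    where
    lowest-terms : ∀ r → Divisible e r → (¬ p ∣ ℚ.↧ₙ r) × (p ^ e ∣ ℤ.∣ ℚ.↥ r ∣)
    lowest-terms (mkℚ n d-1 cop) (divisible z (integral d a p∤d zd≡a) r≡) = p∤den , p^e∣num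
      where
      cleared : ℤ.∣ n ∣ ℕ.* d ≡ p ^ e ℕ.* (ℤ.∣ a ∣ ℕ.* suc d-1)
      cleared = trans (cross-multiply n d-1 (+ (p ^ e) ℤ.* a) cop d
        (trans (cong (_* ℕ→ℚ d) r≡) (trans (ℚP.*-assoc (ℕ→ℚ (p ^ e)) z (ℕ→ℚ d))
          (trans (cong (ℕ→ℚ (p ^ e) *_) zd≡a) (sym (ℤ→ℚ-* (+ (p ^ e)) a))))))
        (trans (cong (ℕ._* suc d-1) (ℤP.abs-* (+ (p ^ e)) a)) (ℕP.*-assoc (p ^ e) ℤ.∣ a ∣ (suc d-1)))
      p^e∣num : p ^ e ∣ ℤ.∣ n ∣
      p^e∣num = p^e∣X*d⇒p^e∣X e ℤ.∣ n ∣ d p∤d (divides (ℤ.∣ a ∣ ℕ.* suc d-1) (trans cleared (ℕP.*-comm (p ^ e) _)))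
      p∤den : ¬ p ∣ suc d-1
      p∤den p∣den with euclidsLemma ℤ.∣ n ∣ d p-prime
        (subst (p ∣_) (sym cleared) (ℕ∣.∣-trans p∣den (ℕ∣.∣-trans (ℕ∣.n∣m*n ℤ.∣ a ∣) (ℕ∣.n∣m*n (p ^ e)))))
      ... | inj₂ p∣d = p∤d p∣d
      ... | inj₁ p∣n = p∤1 (subst (p ∣_) (recompute (coprime? ℤ.∣ n ∣ (suc d-1)) cop (p∣n , p∣den)) ℕ∣.∣-refl)

module PowerSumsModP (p : ℕ) (p-prime : Prime p) where
  open Localisation p p-prime

  BernoulliFacts : ℕ → Set
  BernoulliFacts k = Integral (bernoulli k) × Divisible 2 (powerSum p k - ℕ→ℚ p * bernoulli k)

  bernoulli-facts : ∀ k → suc k ℕ.< p → BernoulliFacts k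
  bernoulli-facts = <-rec (λ k → suc k ℕ.< p → BernoulliFacts k) step
    where
    step : ∀ k → (∀ {j} → j ℕ.< k → suc j ℕ.< p → BernoulliFacts j) → suc k ℕ.< p → BernoulliFacts k
    step zero    _  _ = Integral-ℕ→ℚ 1 , subst (Divisible 2) (sym D₀≡0) (Divisible-0 2)
      where
      D₀≡0 : powerSum p 0 - ℕ→ℚ p * 1ℚ ≡ 0ℚ
      D₀≡0 = trans (cong (_- ℕ→ℚ p * 1ℚ) (sumℚ-const p 1ℚ)) (ℚP.+-inverseʳ (ℕ→ℚ p * 1ℚ))
    step (suc m) IH 2+m<p = Integral-cancel-unit p∤2+m (subst Integral top-B ∫top-B) ,
                            Divisible-cancel-unit p∤2+m (subst (Divisible 2) top-D p²∣top-D)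
      where
      c : ℕ → ℚ
      c j = ℕ→ℚ (suc (suc m) C j)
      D : ℕ → ℚ
      D k = powerSum p k - ℕ→ℚ p * bernoulli k
      p∤2+m : ¬ p ∣ suc (suc m)
      p∤2+m = p∤1+n 2+m<p
      below : ∀ j → j ℕ.< suc m → BernoulliFacts j
      below j j<1+m = IH j<1+m (ℕP.<-trans (s≤s j<1+m) 2+m<p)
      top-coefficient : c (suc m) ≡ ℕ→ℚ (suc (suc m))
      top-coefficient = cong ℕ→ℚ ([1+n]C[n]≡1+n (suc m))
      top-B : 0ℚ - sumℚ (suc m) (λ j → c j * bernoulli j) ≡ ℕ→ℚ (suc (suc m)) * bernoulli (suc m)
      top-B = trans (sym (sumℚ-last (suc m) _ (bernoulli-recurrence m))) (cong (_* bernoulli (suc m)) top-coefficient)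
      ∫top-B : Integral (0ℚ - sumℚ (suc m) (λ j → c j * bernoulli j))
      ∫top-B = Integral-- (Integral-ℕ→ℚ 0)
        (Integral-sum (suc m) (λ j j< → Integral-* (Integral-ℕ→ℚ (suc (suc m) C j)) (proj₁ (below j j<))))
      top-D : ℕ→ℚ (p ^ suc (suc m)) - sumℚ (suc m) (λ k → c k * D k) ≡ ℕ→ℚ (suc (suc m)) * D (suc m)
      top-D = trans (sym (sumℚ-last (suc m) _ (powerSum-bernoulli-binomial p m))) (cong (_* D (suc m)) top-coefficient)
      p²∣top-D : Divisible 2 (ℕ→ℚ (p ^ suc (suc m)) - sumℚ (suc m) (λ k → c k * D k))
      p²∣top-D = Divisible-- (Divisible-p^ 2 m)
        (Divisible-sum (suc m) (λ k k< → Divisible-*ˡ (Integral-ℕ→ℚ (suc (suc m) C k)) (proj₂ (below k k<))))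

  powerSum-divisible : ∀ k → suc k ℕ.< p → Divisible 1 (powerSum p k)
  powerSum-divisible k 1+k<p = subst (Divisible 1) (solve 3 (λ s P b → (s :- P :* b) :+ P :* b := s) refl (powerSum p k) (ℕ→ℚ p) (bernoulli k))
    (Divisible-+ (Divisible-weaken 1 p²∣D) (Integral⇒Divisible-p* ∫B))
    where
    ∫B : Integral (bernoulli k)
    ∫B = proj₁ (bernoulli-facts k 1+k<p)
    p²∣D : Divisible 2 (powerSum p k - ℕ→ℚ p * bernoulli k)
    p²∣D = proj₂ (bernoulli-facts k 1+k<p)

  Integral-sign : ∀ j → Integral (sign j)
  Integral-sign zero    = Integral-ℕ→ℚ 1
  Integral-sign (suc j) = Integral-neg (Integral-sign j)

  signedPowerSum-divisible : ∀ j → suc (suc j) ℕ.< p → Divisible 1 (signedPowerSum p j)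
  signedPowerSum-divisible j 2+j<p = Divisible-*ˡ (Integral-sign j) (powerSum-divisible (suc j) 2+j<p)

  newton-mod-p² : ∀ N k → (∀ i → 1 ℕ.≤ i → i ℕ.≤ k → Divisible 1 (σ N i)) →
    (∀ j → j ℕ.< k → Divisible 1 (signedPowerSum N j)) →
    Divisible 2 (ℕ→ℚ (suc k) * σ N (suc k) - signedPowerSum N k)
  newton-mod-p² N k p∣e p∣s = subst (Divisible 2) (sym lower-terms)
    (Divisible-sum k (λ j j<k → Divisible-* {1} {1} (p∣s j j<k) (p∣e (k ∸ j) (ℕP.m<n⇒0<n∸m j<k) (ℕP.m∸n≤m k j))))
    where
    s : ℕ → ℚ
    s = signedPowerSum N
    lower-terms : ℕ→ℚ (suc k) * σ N (suc k) - s k ≡ sumℚ k (λ j → s j * σ N (k ∸ j))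
    lower-terms = begin
      ℕ→ℚ (suc k) * σ N (suc k) - s k                           ≡⟨ cong (_- s k) (newton-identity N k) ⟩
      (sumℚ k (λ j → s j * σ N (k ∸ j)) + s k * σ N (k ∸ k)) - s k  ≡⟨ cong (λ i → (sumℚ k (λ j → s j * σ N (k ∸ j)) + s k * σ N i) - s k) (ℕP.n∸n≡0 k) ⟩
      (sumℚ k (λ j → s j * σ N (k ∸ j)) + s k * 1ℚ) - s k        ≡⟨ solve 2 (λ a s → (a :+ s :* con 1ℚ) :- s := a) refl _ (s k) ⟩
      sumℚ k (λ j → s j * σ N (k ∸ j))                           ∎
      where open ≡-Reasoning

  σ-divisible : ∀ k → suc (suc k) ℕ.< p → Divisible 1 (σ p (suc k))
  σ-divisible = <-rec (λ k → suc (suc k) ℕ.< p → Divisible 1 (σ p (suc k))) step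
    where
    step : ∀ k → (∀ {i} → i ℕ.< k → suc (suc i) ℕ.< p → Divisible 1 (σ p (suc i))) →
      suc (suc k) ℕ.< p → Divisible 1 (σ p (suc k))
    step k IH 2+k<p = Divisible-cancel-unit (p∤1+n (ℕP.<-trans (ℕP.n<1+n (suc k)) 2+k<p))
      (subst (Divisible 1) (solve 2 (λ x s → (x :- s) :+ s := x) refl (ℕ→ℚ (suc k) * σ p (suc k)) (signedPowerSum p k))
        (Divisible-+ (Divisible-weaken 1 (newton-mod-p² p k lower-e lower-s)) (signedPowerSum-divisible k 2+k<p)))
      where
      lower-e : ∀ i → 1 ℕ.≤ i → i ℕ.≤ k → Divisible 1 (σ p i)
      lower-e (suc i) _ 1+i≤k = IH 1+i≤k (ℕP.<-trans (s≤s (s≤s 1+i≤k)) 2+k<p)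
      lower-s : ∀ j → j ℕ.< k → Divisible 1 (signedPowerSum p j)
      lower-s j j<k = signedPowerSum-divisible j (ℕP.<-trans (s≤s (s≤s j<k)) 2+k<p)

  newton-congruence : ∀ k → suc k ℕ.< p → Divisible 2 (ℕ→ℚ (suc k) * σ p (suc k) - signedPowerSum p k)
  newton-congruence k 1+k<p = newton-mod-p² p k lower-e lower-s
    where
    lower-e : ∀ i → 1 ℕ.≤ i → i ℕ.≤ k → Divisible 1 (σ p i)
    lower-e (suc i) _ 1+i≤k = σ-divisible i (ℕP.≤-<-trans (s≤s 1+i≤k) 1+k<p)
    lower-s : ∀ j → j ℕ.< k → Divisible 1 (signedPowerSum p j)
    lower-s j j<k = signedPowerSum-divisible j (ℕP.≤-<-trans (s≤s j<k) 1+k<p)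

  p∣pC[1+k] : ∀ k → suc k ℕ.< p → p ∣ p C suc k
  p∣pC[1+k] k 1+k<p with euclidsLemma (suc k) (p C suc k) p-prime (divides (ℕ.pred p C k) absorption)
    where
    absorption : suc k ℕ.* (p C suc k) ≡ (ℕ.pred p C k) ℕ.* p
    absorption = subst (λ n → suc k ℕ.* (n C suc k) ≡ (ℕ.pred p C k) ℕ.* n) (ℕP.suc-pred p)
      (trans ([1+k]*[1+n]C[1+k]≡[1+n]*nCk (ℕ.pred p) k) (ℕP.*-comm (suc (ℕ.pred p)) _))
  ... | inj₁ p∣1+k = contradiction p∣1+k (p∤1+n 1+k<p)
  ... | inj₂ p∣C   = p∣C

½ ⅓ : ℚ
½ = 1/suc 1
⅓ = 1/suc 2

-- Each hypothesis has a variable on its left, so matching it with refl substitutes it and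
-- what remains is ring normalisation.
weighted-H₂-identity : ∀ Y H₂ R₁ R₃ B {P H₀ A H₁ H₃} →
  P ≡ Y + 1ℚ → H₀ ≡ Y * 1ℚ →
  A ≡ ½ * (P * Y * H₂ - H₀ + H₁) →
  H₁ ≡ ½ * (- (P * H₂) - P * P * H₃ + P * P * P * R₁) →
  H₃ ≡ ½ * (P * R₃) →
  A - ((- ((P * P) * (½ * B)) - (P * ½)) + ½)
    ≡ ½ * (P * (P * H₂)) - ½ * (½ * (P * (ℕ→ℚ 3 * H₂ - ℕ→ℚ 2 * (P * B))))
      - ½ * (½ * (½ * (P * (P * (P * R₃))))) + ½ * (½ * (P * (P * (P * R₁))))
weighted-H₂-identity Y H₂ R₁ R₃ B refl refl refl refl refl = solve 5 (λ Y H₂ R₁ R₃ B →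
    let P = Y :+ con 1ℚ
        H₃ = con ½ :* (P :* R₃)
        H₁ = con ½ :* (:- (P :* H₂) :- P :* P :* H₃ :+ P :* P :* P :* R₁)
    in con ½ :* (P :* Y :* H₂ :- Y :* con 1ℚ :+ H₁) :- ((:- ((P :* P) :* (con ½ :* B)) :- (P :* con ½)) :+ con ½)
       := con ½ :* (P :* (P :* H₂)) :- con ½ :* (con ½ :* (P :* (con (ℕ→ℚ 3) :* H₂ :- con (ℕ→ℚ 2) :* (P :* B))))
          :- con ½ :* (con ½ :* (con ½ :* (P :* (P :* (P :* R₃))))) :+ con ½ :* (con ½ :* (P :* (P :* (P :* R₁)))))
  refl Y H₂ R₁ R₃ B

weighted-H₃-identity : ∀ P Y H₁ H₂ H₃ B {A} → A ≡ ½ * (P * Y * H₃ - H₁ + H₂) →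
  A - ⅓ * (P * B) ≡ ½ * (P * (Y * H₃)) - ½ * H₁ + ½ * (⅓ * (ℕ→ℚ 3 * H₂ - ℕ→ℚ 2 * (P * B)))
weighted-H₃-identity P Y H₁ H₂ H₃ B refl = solve 6 (λ P Y H₁ H₂ H₃ B →
    con ½ :* (P :* Y :* H₃ :- H₁ :+ H₂) :- con ⅓ :* (P :* B)
    := con ½ :* (P :* (Y :* H₃)) :- con ½ :* H₁ :+ con ½ :* (con ⅓ :* (con (ℕ→ℚ 3) :* H₂ :- con (ℕ→ℚ 2) :* (P :* B))))
  refl P Y H₁ H₂ H₃ B

weighted-H₄-identity : ∀ P Y H₂ H₃ H₄ {A} → A ≡ ½ * (P * Y * H₄ - H₂ + H₃) →
  A - ℕ→ℚ 0 ≡ ½ * (P * (Y * H₄) - H₂ + H₃)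
weighted-H₄-identity P Y H₂ H₃ H₄ refl = solve 5 (λ P Y H₂ H₃ H₄ →
    con ½ :* (P :* Y :* H₄ :- H₂ :+ H₃) :- con (ℕ→ℚ 0) := con ½ :* (P :* (Y :* H₄) :- H₂ :+ H₃))
  refl P Y H₂ H₃ H₄

module OddPrime (t : ℕ) (p-prime : Prime (5 ℕ.+ (t ℕ.+ t))) where
  p : ℕ
  p = 5 ℕ.+ (t ℕ.+ t)

  open Localisation p p-prime
  open PowerSumsModP p p-prime

  below-p : ∀ {k} → k < 5 → k ℕ.+ (t ℕ.+ t) < p
  below-p = ℕP.+-monoˡ-< (t ℕ.+ t)

  newton-at-p-3 : Divisible 2 (ℕ→ℚ (p ∸ 3) * σ p (p ∸ 3) + powerSum p (p ∸ 3))
  newton-at-p-3 = subst (Divisible 2) (trans (cong (λ s → x - s * y) (sign-odd t))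
      (solve 2 (λ x y → x :- (:- con 1ℚ) :* y := x :+ y) refl x y))
    (newton-congruence (suc (t ℕ.+ t)) (below-p (s≤s (s≤s (s≤s z≤n)))))
    where
    x y : ℚ
    x = ℕ→ℚ (p ∸ 3) * σ p (p ∸ 3)
    y = powerSum p (p ∸ 3)

  newton-at-p-1 : Divisible 2 (ℕ→ℚ (p ∸ 1) * σ p (p ∸ 1) + powerSum p (p ∸ 1))
  newton-at-p-1 = subst (Divisible 2) (trans (cong (λ s → x - (- - s) * y) (sign-odd t))
      (solve 2 (λ x y → x :- (:- (:- (:- con 1ℚ))) :* y := x :+ y) refl x y))
    (newton-congruence (3 ℕ.+ (t ℕ.+ t)) (below-p (s≤s (s≤s (s≤s (s≤s (s≤s z≤n)))))))
    where
    x y : ℚ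
    x = ℕ→ℚ (p ∸ 1) * σ p (p ∸ 1)
    y = powerSum p (p ∸ 1)

  -- In p^p = Σ_{k<p} C(p,k) S_k(p) the terms with 0 < k < p - 1 lie in p², the outer ones are p and p S_{p-1}.
  powerSum-at-p-1 : Divisible 1 (1ℚ + powerSum p (p ∸ 1))
  powerSum-at-p-1 = Divisible-cancel-p (subst (Divisible 2) (isolate-top (ℕ→ℚ p) (powerSum p (suc m)) (sumℚ m (λ j → f (suc j))) (sumℚ-const p 1ℚ) top-coefficient expansion)
    (Divisible-- (Divisible-p^ 2 m) (Divisible-sum m middle)))
    where
    m : ℕ
    m = 3 ℕ.+ (t ℕ.+ t)
    f : ℕ → ℚ
    f k = ℕ→ℚ (p C k) * powerSum p k
    expansion : f 0 + sumℚ m (λ j → f (suc j)) + f (suc m) ≡ ℕ→ℚ (p ^ p)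
    expansion = trans (cong (_+ f (suc m)) (sym (sumℚ-unshift m f))) (powerSum-binomial p (suc m))
    top-coefficient : f (suc m) ≡ ℕ→ℚ p * powerSum p (suc m)
    top-coefficient = cong (λ c → ℕ→ℚ c * powerSum p (suc m)) ([1+n]C[n]≡1+n (suc m))
    middle : ∀ j → j < m → Divisible 2 (f (suc j))
    middle j j<m = Divisible-* {1} {1} (Divisible-ℕ→ℚ (p∣pC[1+k] j 1+j<p)) (powerSum-divisible (suc j) (s≤s (s≤s j<m)))
      where
      1+j<p : suc j < p
      1+j<p = ℕP.<-trans (s≤s j<m) (ℕP.n<1+n _)
    isolate-top : ∀ P S Σ {S₀ fₙ Q} → S₀ ≡ P * 1ℚ → fₙ ≡ P * S → 1ℚ * S₀ + Σ + fₙ ≡ Q → Q - Σ ≡ P * (1ℚ + S)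
    isolate-top P S Σ refl refl refl = solve 3 (λ P S Σ → con 1ℚ :* (P :* con 1ℚ) :+ Σ :+ P :* S :- Σ := P :* (con 1ℚ :+ S)) refl P S Σ

  wilson : Divisible 1 (ℕ→ℚ ((p ∸ 1) !) + 1ℚ)
  wilson = subst (Divisible 1) (identity (ℕ→ℚ (p ∸ 1)) (ℕ→ℚ ((p ∸ 1) !)) (ℕ→ℚ-+ 1 (p ∸ 1)) (σ-top (p ∸ 1)))
    (Divisible-+ (Divisible-- (Integral⇒Divisible-p* (Integral-ℕ→ℚ ((p ∸ 1) !))) (Divisible-weaken 1 newton-at-p-1)) powerSum-at-p-1)
    where
    S : ℚ
    S = powerSum p (p ∸ 1)
    identity : ∀ Y W {P E} → P ≡ 1ℚ + Y → E ≡ W → P * W - (Y * E + S) + (1ℚ + S) ≡ W + 1ℚ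
    identity Y W refl refl = solve 3 (λ Y W S → (con 1ℚ :+ Y) :* W :- (Y :* W :+ S) :+ (con 1ℚ :+ S) := W :+ con 1ℚ) refl Y W S

  W F B : ℚ
  W = ℕ→ℚ ((p ∸ 1) !)
  F = H₁₁ (p ∸ 1)
  B = bernoulli (p ∸ 3)

  Integral-F : Integral F
  Integral-F = Integral-sum (p ∸ 1) λ i i<p-1 →
    Integral-* (Integral-H 1 (ℕP.<-trans i<p-1 (ℕP.n<1+n _))) (Integral-1/suc (p∤1+n (s≤s i<p-1)))

  σ-at-p-3-divisible : Divisible 1 (σ p (p ∸ 3))
  σ-at-p-3-divisible = σ-divisible (suc (t ℕ.+ t)) (below-p (s≤s (s≤s (s≤s (s≤s z≤n)))))

  F-divisible : Divisible 1 F
  F-divisible = subst (Divisible 1) (identity W F (σ-top-2 (p ∸ 3)))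
    (Divisible-- (Divisible-* {1} {0} wilson (Integral⇒Divisible⁰ Integral-F)) σ-at-p-3-divisible)
    where
    identity : ∀ W F {E} → E ≡ W * F → (W + 1ℚ) * F - E ≡ F
    identity W F refl = solve 2 (λ W F → (W :+ con 1ℚ) :* F :- W :* F := F) refl W F

  σ+F-divisible : Divisible 2 (σ p (p ∸ 3) + F)
  σ+F-divisible = subst (Divisible 2) (identity W F (σ-top-2 (p ∸ 3))) (Divisible-* {1} {1} wilson F-divisible)
    where
    identity : ∀ W F {E} → E ≡ W * F → (W + 1ℚ) * F ≡ E + F
    identity W F refl = solve 2 (λ W F → (W :+ con 1ℚ) :* F := W :* F :+ F) refl W F

  3F+pB-divisible : Divisible 2 (ℕ→ℚ 3 * F + ℕ→ℚ p * B)
  3F+pB-divisible = subst (Divisible 2) (identity (ℕ→ℚ (p ∸ 3)) (σ p (p ∸ 3)) (powerSum p (p ∸ 3)) (ℕ→ℚ-+ 3 (p ∸ 3)))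
    (Divisible-+ (Divisible-- (Divisible-- newton-at-p-3 D-divisible) (Divisible-*ˡ (Integral-ℕ→ℚ (p ∸ 3)) σ+F-divisible))
      (Divisible-p* F-divisible))
    where
    D-divisible : Divisible 2 (powerSum p (p ∸ 3) - ℕ→ℚ p * B)
    D-divisible = proj₂ (bernoulli-facts (p ∸ 3) (below-p (s≤s (s≤s (s≤s (s≤s z≤n))))))
    identity : ∀ M E S {P} → P ≡ ℕ→ℚ 3 + M → (M * E + S) - (S - P * B) - M * (E + F) + P * F ≡ ℕ→ℚ 3 * F + P * B
    identity M E S refl = solve 5 (λ M E S F B →
      (M :* E :+ S) :- (S :- (con (ℕ→ℚ 3) :+ M) :* B) :- M :* (E :+ F) :+ (con (ℕ→ℚ 3) :+ M) :* F
      := con (ℕ→ℚ 3) :* F :+ (con (ℕ→ℚ 3) :+ M) :* B) refl M E S F B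

  N : ℕ
  N = p ∸ 1
  P : ℚ
  P = ℕ→ℚ p
  open Reflection N using (R₁; R₃; H₁-reflection; H₃-reflection)

  Integral-1/[1+i] : ∀ {i} → i < N → Integral (1/suc i)
  Integral-1/[1+i] i<N = Integral-1/suc (p∤1+n (s≤s i<N))

  Integral-1/[N-i] : ∀ {i} → i < N → Integral (1/suc (N ∸ suc i))
  Integral-1/[N-i] {i} i<N = Integral-1/suc (p∤1+n (s≤s (subst (ℕ._≤ N) (ℕP.+-∸-assoc 1 i<N) (ℕP.m∸n≤m N i))))

  Integral-R₁ : Integral R₁
  Integral-R₁ = Integral-sum N λ i i<N → let ∫u = Integral-1/[1+i] i<N; ∫v = Integral-1/[N-i] i<N in
    Integral-* ∫u (Integral-* ∫u (Integral-* ∫u ∫v))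

  Integral-R₃ : Integral R₃
  Integral-R₃ = Integral-sum N λ i i<N → let ∫u = Integral-1/[1+i] i<N; ∫v = Integral-1/[N-i] i<N in
    Integral-* (Integral-* ∫u ∫v) (Integral-+ (Integral-- (Integral-* ∫u ∫u) (Integral-* ∫u ∫v)) (Integral-* ∫v ∫v))

  Integral-H[N] : ∀ m → Integral (H m N)
  Integral-H[N] m = Integral-H m (ℕP.n<1+n N)

  H₁-reflection′ : ℕ→ℚ 2 * H 1 N ≡ P * (- H 2 N - P * H 3 N + P * (P * R₁))
  H₁-reflection′ = trans H₁-reflection
    (solve 4 (λ P a b r → :- (P :* a) :- P :* P :* b :+ P :* P :* P :* r := P :* (:- a :- P :* b :+ P :* (P :* r))) refl P (H 2 N) (H 3 N) R₁)

  p∤2 : ¬ p ∣ 2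
  p∤2 = p∤1+n (s≤s (s≤s (s≤s z≤n)))

  p∤3 : ¬ p ∣ 3
  p∤3 = p∤1+n (s≤s (s≤s (s≤s (s≤s z≤n))))

  Integral-½ : Integral ½
  Integral-½ = Integral-1/suc p∤2

  Integral-⅓ : Integral ⅓
  Integral-⅓ = Integral-1/suc p∤3

  H₁-divisible : Divisible 1 (H 1 N)
  H₁-divisible = Divisible-cancel-unit p∤2 (subst (Divisible 1) (sym H₁-reflection′) (Integral⇒Divisible-p*
    (Integral-+ (Integral-- (Integral-neg (Integral-H[N] 2)) (Integral-* (Integral-ℕ→ℚ p) (Integral-H[N] 3)))
      (Integral-* (Integral-ℕ→ℚ p) (Integral-* (Integral-ℕ→ℚ p) Integral-R₁)))))

  H₃-divisible : Divisible 1 (H 3 N)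
  H₃-divisible = Divisible-cancel-unit p∤2 (subst (Divisible 1) (sym H₃-reflection) (Integral⇒Divisible-p* Integral-R₃))

  3H₂-2pB-divisible : Divisible 2 (ℕ→ℚ 3 * H 2 N - ℕ→ℚ 2 * (P * B))
  3H₂-2pB-divisible = subst (Divisible 2) (identity (H 2 N) (H₁-square N))
    (Divisible-- (Divisible-*ˡ (Integral-ℕ→ℚ 3) (Divisible-* {1} {1} H₁-divisible H₁-divisible))
      (Divisible-*ˡ (Integral-ℕ→ℚ 2) 3F+pB-divisible))
    where
    identity : ∀ H₂ {Q} → Q ≡ H₂ + ℕ→ℚ 2 * F → ℕ→ℚ 3 * Q - ℕ→ℚ 2 * (ℕ→ℚ 3 * F + P * B) ≡ ℕ→ℚ 3 * H₂ - ℕ→ℚ 2 * (P * B)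
    identity H₂ refl = solve 3 (λ H₂ F X → con (ℕ→ℚ 3) :* (H₂ :+ con (ℕ→ℚ 2) :* F) :- con (ℕ→ℚ 2) :* (con (ℕ→ℚ 3) :* F :+ X)
      := con (ℕ→ℚ 3) :* H₂ :- con (ℕ→ℚ 2) :* X) refl H₂ F (P * B)

  H₂-divisible : Divisible 1 (H 2 N)
  H₂-divisible = Divisible-cancel-unit p∤3 (subst (Divisible 1)
    (solve 2 (λ a b → (a :- b) :+ b := a) refl (ℕ→ℚ 3 * H 2 N) (ℕ→ℚ 2 * (P * B)))
    (Divisible-+ (Divisible-weaken 1 3H₂-2pB-divisible) (Divisible-*ˡ (Integral-ℕ→ℚ 2) (Integral⇒Divisible-p* Integral-B))))
    where
    Integral-B : Integral B
    Integral-B = proj₁ (bernoulli-facts (p ∸ 3) (below-p (s≤s (s≤s (s≤s (s≤s z≤n))))))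

  H₁-divisible² : Divisible 2 (H 1 N)
  H₁-divisible² = Divisible-cancel-unit p∤2 (subst (Divisible 2) (sym H₁-reflection′) (Divisible-p*
    (Divisible-+ (Divisible-- (Divisible-neg H₂-divisible) (Integral⇒Divisible-p* (Integral-H[N] 3)))
      (Integral⇒Divisible-p* (Integral-* (Integral-ℕ→ℚ p) Integral-R₁)))))

  weighted-sum : ∀ m → sumℚ p (λ k → ℕ→ℚ k * H (suc (suc m)) k) ≡ ½ * (P * ℕ→ℚ N * H (suc (suc m)) N - H m N + H (suc m) N)
  weighted-sum m = 1/suc-solve 1 (weighted-harmonic-sum m N)

  congruences :
    (sumℚ p (λ k → ℕ→ℚ k * H 2 k)
       ≡ (- ((ℕ→ℚ p * ℕ→ℚ p) * ((+ 1 / 2) * bernoulli (p ∸ 3))) - (ℕ→ℚ p * (+ 1 / 2))) + (+ 1 / 2)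
       [modℚ p ^ 3 ])
    × (sumℚ p (λ k → ℕ→ℚ k * H 3 k)
       ≡ (+ 1 / 3) * (ℕ→ℚ p * bernoulli (p ∸ 3))
       [modℚ p ^ 2 ])
    × (sumℚ p (λ k → ℕ→ℚ k * H 4 k)
       ≡ ℕ→ℚ 0
       [modℚ p ^ 1 ])
  congruences = Divisible⇒≡[modℚ] (A 2) _ order-2 , Divisible⇒≡[modℚ] (A 3) _ order-3 , Divisible⇒≡[modℚ] (A 4) (ℕ→ℚ 0) order-4
    where
    A : ℕ → ℚ
    A m = sumℚ p (λ k → ℕ→ℚ k * H m k)
    ½* : ∀ {e x} → Divisible e x → Divisible e (½ * x)
    ½* = Divisible-*ˡ Integral-½
    order-2 : Divisible 3 (A 2 - ((- ((P * P) * (½ * B)) - (P * ½)) + ½))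
    order-2 = subst (Divisible 3)
      (sym (weighted-H₂-identity (ℕ→ℚ N) (H 2 N) R₁ R₃ B (ℕ→ℚ-suc N) (sumℚ-const N 1ℚ) (weighted-sum 0)
        (1/suc-solve 1 H₁-reflection) (1/suc-solve 1 H₃-reflection)))
      (Divisible-+ (Divisible-- (Divisible-- (½* (Divisible-p* (Divisible-p* H₂-divisible)))
                                             (½* (½* (Divisible-p* 3H₂-2pB-divisible))))
                                (½* (½* (½* (Divisible-p* (Divisible-p* (Integral⇒Divisible-p* Integral-R₃)))))))
                   (½* (½* (Divisible-p* (Divisible-p* (Integral⇒Divisible-p* Integral-R₁))))))
    order-3 : Divisible 2 (A 3 - ⅓ * (P * B))
    order-3 = subst (Divisible 2) (sym (weighted-H₃-identity P (ℕ→ℚ N) (H 1 N) (H 2 N) (H 3 N) B (weighted-sum 1)))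
      (Divisible-+ (Divisible-- (½* (Divisible-p* (Divisible-*ˡ (Integral-ℕ→ℚ N) H₃-divisible))) (½* H₁-divisible²))
                   (½* (Divisible-*ˡ Integral-⅓ 3H₂-2pB-divisible)))
    order-4 : Divisible 1 (A 4 - ℕ→ℚ 0)
    order-4 = subst (Divisible 1) (sym (weighted-H₄-identity P (ℕ→ℚ N) (H 2 N) (H 3 N) (H 4 N) (weighted-sum 2)))
      (½* (Divisible-+ (Divisible-- (Integral⇒Divisible-p* (Integral-* (Integral-ℕ→ℚ N) (Integral-H[N] 4))) H₂-divisible) H₃-divisible))

even-or-odd : ∀ n → (∃[ t ] n ≡ t ℕ.+ t) ⊎ (∃[ t ] n ≡ suc (t ℕ.+ t))
even-or-odd zero    = inj₁ (0 , refl)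
even-or-odd (suc n) with even-or-odd n
... | inj₁ (t , refl) = inj₂ (t , refl)
... | inj₂ (t , refl) = inj₁ (suc t , cong suc (sym (ℕP.+-suc t t)))

prime>3⇒≡5+2t : ∀ {p} → Prime p → 3 < p → ∃[ t ] p ≡ 5 ℕ.+ (t ℕ.+ t)
prime>3⇒≡5+2t {p} p-prime 3<p with even-or-odd p
... | inj₁ (t , refl) with prime⇒irreducible p-prime (divides t (trans (cong (t ℕ.+_) (sym (ℕP.+-identityʳ t))) (ℕP.*-comm 2 t)))
...   | inj₁ ()
...   | inj₂ 2≡t+t = contradiction (subst (3 <_) (sym 2≡t+t) 3<p) λ { (s≤s (s≤s ())) }
prime>3⇒≡5+2t p-prime (s≤s ()) | inj₂ (0 , refl)
prime>3⇒≡5+2t p-prime 3<p | inj₂ (1 , refl) = contradiction 3<p (ℕP.<-irrefl refl)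
prime>3⇒≡5+2t p-prime 3<p | inj₂ (suc (suc t) , refl) = t , cong (λ n → suc (suc (suc n))) (trans (ℕP.+-suc t (suc t)) (cong suc (ℕP.+-suc t t)))

lemma2p3 : (p : ℕ) → Prime p → 3 < p →
    (sumℚ p (λ k → ℕ→ℚ k * H 2 k)
       ≡ (- ((ℕ→ℚ p * ℕ→ℚ p) * ((+ 1 / 2) * bernoulli (p ∸ 3))) - (ℕ→ℚ p * (+ 1 / 2))) + (+ 1 / 2)
       [modℚ p ^ 3 ])
    × (sumℚ p (λ k → ℕ→ℚ k * H 3 k)
       ≡ (+ 1 / 3) * (ℕ→ℚ p * bernoulli (p ∸ 3))
       [modℚ p ^ 2 ])
    × (sumℚ p (λ k → ℕ→ℚ k * H 4 k)
       ≡ ℕ→ℚ 0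
       [modℚ p ^ 1 ])
lemma2p3 p p-prime 3<p with prime>3⇒≡5+2t p-prime 3<p
... | t , refl = OddPrime.congruences t p-prime
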